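{- Among all $3$-edge-connected cubic graphs on at most $10$ vertices, the Petersen graph is the only one with Frank number greater than $2$; every other such graph has Frank number $2$.
   Context: Graphs are finite and simple. An orientation of a graph replaces each edge $uv$ by exactly one of the arcs $(u,v)$, $(v,u)$. An oriented graph is strongly connected if for any two vertices $x,y$ there is a directed $(x,y)$-path. In an orientation $O$ of $G$, an edge $e$ is deletable if $O-e$ is strongly connected. For a $3$-edge-connected graph $G$, the Frank number $F(G)$ is the minimum $k$ such that $G$ admits $k$ orientations with the property that every edge of $G$ is deletable in at least one of them. -}

module Defs where

open import Data.Nat using (ℕ; zero; suc; _≤_; _<_; _≡ᵇ_)
open import Data.Bool using (Bool; true; false; _∧_; _∨_; not)
open import Data.Fin using (Fin; toℕ; _≟_)
open import Data.List using (List; []; _∷_; length; filterᵇ; allFin)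
open import Data.Bool.ListAction using (any)
open import Data.Product using (Σ; ∃; _×_; _,_)
open import Relation.Nullary using (¬_)
open import Relation.Nullary.Decidable using (⌊_⌋)
open import Relation.Binary.PropositionalEquality using (_≡_)
open import Function.Bundles using (_↔_; Inverse)

Adj : ℕ → Set
Adj n = Fin n → Fin n → Bool

record IsSimple {n : ℕ} (G : Adj n) : Set where
  field
    symm    : ∀ u v → G u v ≡ G v u
    irrefl  : ∀ u → G u u ≡ false

degree : ∀ {n} → Adj n → Fin n → ℕ
degree {n} G v = length (filterᵇ (G v) (allFin n))

Cubic : ∀ {n} → Adj n → Set
Cubic {n} G = ∀ (v : Fin n) → degree G v ≡ 3

data Reach {n : ℕ} (R : Adj n) : Fin n → Fin n → Set where
  here : ∀ {u} → Reach R u u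
  step : ∀ {u v w} → R u v ≡ true → Reach R v w → Reach R u w

-- every vertex reaches every vertex; for a symmetric relation this is
-- connectivity, for an orientation it is strong connectivity
StronglyConnected : ∀ {n} → Adj n → Set
StronglyConnected {n} R = ∀ (x y : Fin n) → Reach R x y

Connected : ∀ {n} → Adj n → Set
Connected = StronglyConnected

removeEdge : ∀ {n} → Adj n → Fin n → Fin n → Adj n
removeEdge R u v x y =
  R x y ∧ not ((⌊ x ≟ u ⌋ ∧ ⌊ y ≟ v ⌋) ∨ (⌊ x ≟ v ⌋ ∧ ⌊ y ≟ u ⌋))

-- 3-edge-connected: at least 2 vertices, and deleting any set of at most
-- two edges leaves the graph connected (pairs may coincide / be non-edges,
-- which covers deleting 0, 1 or 2 edges).
ThreeEdgeConnected : ∀ {n} → Adj n → Set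
ThreeEdgeConnected {n} G =
  2 ≤ n × (∀ (a b c d : Fin n) → Connected (removeEdge (removeEdge G a b) c d))

record Orientation {n : ℕ} (G : Adj n) : Set where
  field
    arc     : Adj n
    onEdges : ∀ u v → arc u v ≡ true → G u v ≡ true
    exactlyOne : ∀ u v → G u v ≡ true → arc u v ≡ not (arc v u)
open Orientation public

Deletable : ∀ {n} {G : Adj n} → Orientation G → Fin n → Fin n → Set
Deletable O u v = StronglyConnected (removeEdge (arc O) u v)

Covers : ∀ {n} → Adj n → ℕ → Set
Covers {n} G k =
  Σ (Fin k → Orientation G) λ Os →
    ∀ (u v : Fin n) → G u v ≡ true → ∃ λ (i : Fin k) → Deletable (Os i) u v

IsFrankNumber : ∀ {n} → Adj n → ℕ → Set
IsFrankNumber G k = Covers G k × (∀ j → j < k → ¬ Covers G j)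

-- The Petersen graph on Fin 10: outer 5-cycle 0..4, spokes i–(i+5),
-- inner pentagram 5–7–9–6–8–5.
petersenEdges : List (ℕ × ℕ)
petersenEdges =
  (0 , 1) ∷ (1 , 2) ∷ (2 , 3) ∷ (3 , 4) ∷ (4 , 0) ∷
  (0 , 5) ∷ (1 , 6) ∷ (2 , 7) ∷ (3 , 8) ∷ (4 , 9) ∷
  (5 , 7) ∷ (7 , 9) ∷ (9 , 6) ∷ (6 , 8) ∷ (8 , 5) ∷ []

isPetEdge : ℕ → ℕ → Bool
isPetEdge a b = any (λ { (x , y) → (x ≡ᵇ a) ∧ (y ≡ᵇ b) }) petersenEdges

petersen : Adj 10
petersen u v = isPetEdge (toℕ u) (toℕ v) ∨ isPetEdge (toℕ v) (toℕ u)

Isomorphic : ∀ {n m} → Adj n → Adj m → Set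
Isomorphic {n} {m} G H =
  Σ (Fin n ↔ Fin m) λ f →
    ∀ (u v : Fin n) → G u v ≡ H (Inverse.to f u) (Inverse.to f v)

-- One orientation never suffices for a cubic graph: two of the three edges at a vertex
-- point the same way, and deleting the third leaves that vertex a source or a sink.
--
-- Every 3-edge-connected cubic graph on at most 10 vertices is isomorphic to an
-- adjacency matrix numbered in breadth-first order.  A case split over the entries of
-- such matrices, pruned by the degree and breadth-first constraints, ends in leaves each
-- settled by a certificate: two orientations in which every edge is deletable, two edges
-- whose removal disconnects the graph, or an isomorphism with the Petersen graph.
--
-- For the Petersen graph, an automorphism and reversals bring any two covering
-- orientations into a fixed pattern at vertex 0, and a second case split over the
-- remaining edge directions, pruned by edges whose deletion creates a source or a sink,
-- leaves no possibility.

module Submission where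

open import Defs

import Data.Bool as Bool
open import Data.Bool using (Bool; true; false; _∧_; _∨_; not; if_then_else_; T?)
open import Data.Bool.Properties using (∨-comm; ∧-comm; ∨-zeroʳ; ∧-zeroʳ; T-≡)
open import Data.Empty using (⊥; ⊥-elim)
open import Data.Fin as Fin using (Fin; toℕ; fromℕ<; _≟_; inject≤; #_)
open import Data.Fin.Patterns using (0F; 1F; 2F; 3F; 4F; 5F; 6F; 7F; 8F; 9F)
open import Data.Fin.Properties using (toℕ-injective; toℕ<n; toℕ-fromℕ<; toℕ-inject≤; injective⇒≤; pigeonhole)
open import Data.List as List using (List; []; _∷_; _++_; length; filterᵇ; allFin)
open import Data.List.Membership.Propositional using (_∈_)
open import Data.List.Membership.Propositional.Properties using (∈-filter⁺; ∈-filter⁻; ∈-allFin; ∈-lookup)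
open import Data.List.Relation.Unary.All as All using (All; []; _∷_)
open import Data.List.Relation.Unary.AllPairs using ([]; _∷_)
open import Data.List.Relation.Unary.Any using (here; there)
open import Data.List.Relation.Unary.Unique.Propositional using (Unique)
open import Data.List.Relation.Unary.Unique.Propositional.Properties using (allFin⁺; filter⁺)
open import Data.Maybe using (Maybe; just; nothing; is-just; _>>=_)
open import Data.Nat as ℕ using (ℕ; zero; suc; _≤_; _<_; z≤n; s≤s; _<ᵇ_; _≤ᵇ_; _≡ᵇ_; _*_; _+_; _≤?_)
open import Data.Nat.DivMod using (_/_; _%_)
open import Data.Nat.Properties as ℕₚ
  using (≤-refl; ≤-trans; <⇒≤; n<1+n; m<n⇒m<1+n; ≤-<-trans; <-irrefl; <-trans; <-cmp; m<1+n⇒m<n∨m≡n; ≰⇒>)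
open import Data.Product using (Σ; ∃; ∃₂; _×_; _,_; proj₁; proj₂)
open import Data.Sum using (_⊎_; inj₁; inj₂; [_,_]′)
open import Data.Unit using (⊤)
open import Data.Vec as Vec using (Vec; lookup; _[_]≔_; replicate; tabulate; updateAt)
open import Data.Vec.Properties
  using (lookup∘updateAt; lookup∘updateAt′; lookup∘update; lookup∘update′; lookup∘tabulate; lookup-replicate)
open import Function using (flip; _∘_)
open import Function.Bundles using (Inverse; mk↔ₛ′; Equivalence)
open import Function.Properties.Inverse using (↔-sym; ↔-trans)
open import Relation.Binary using (tri<; tri≈; tri>)
open import Relation.Binary.PropositionalEquality
open import Relation.Nullary using (¬_; yes; no)
open import Relation.Nullary.Decidable using (⌊_⌋)

false≢true : false ≢ true
false≢true ()

∧-elimˡ : ∀ {a b} → a ∧ b ≡ true → a ≡ true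
∧-elimˡ {true} _ = refl

∧-elimʳ : ∀ {a b} → a ∧ b ≡ true → b ≡ true
∧-elimʳ {true} e = e

∧-intro : ∀ {a b} → a ≡ true → b ≡ true → a ∧ b ≡ true
∧-intro refl refl = refl

∨-elim : ∀ {a b} → a ∨ b ≡ true → a ≡ true ⊎ b ≡ true
∨-elim {true} _ = inj₁ refl
∨-elim {false} e = inj₂ e

not-true : ∀ {a} → not a ≡ true → a ≡ false
not-true {false} _ = refl

not-false : ∀ {a} → not a ≡ false → a ≡ true
not-false {true} _ = refl

T⇒≡true : ∀ {a} → Bool.T a → a ≡ true
T⇒≡true = Equivalence.to T-≡

≡true⇒T : ∀ {a} → a ≡ true → Bool.T a
≡true⇒T = Equivalence.from T-≡

infixr 5 _⇒ᵇ_
_⇒ᵇ_ : Bool → Bool → Bool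
a ⇒ᵇ b = not a ∨ b

⇒ᵇ-elim : ∀ {a b} → a ⇒ᵇ b ≡ true → a ≡ true → b ≡ true
⇒ᵇ-elim {true} e refl = e

infix 7 _==_
_==_ : Bool → Bool → Bool
a == b = if a then b else not b

==-sound : ∀ {a b} → a == b ≡ true → a ≡ b
==-sound {true} {true} _ = refl
==-sound {false} {false} _ = refl

is-just-true : Maybe Bool → Bool
is-just-true (just true) = true
is-just-true _ = false

is-just-false : Maybe Bool → Bool
is-just-false (just false) = true
is-just-false _ = false

is-just-true-sound : ∀ {x} → is-just-true x ≡ true → x ≡ just true
is-just-true-sound {just true} _ = refl

is-just-false-sound : ∀ {x} → is-just-false x ≡ true → x ≡ just false
is-just-false-sound {just false} _ = refl

is-just-sound : ∀ {A : Set} {x : Maybe A} → is-just x ≡ true → Σ A λ a → x ≡ just a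
is-just-sound {x = just a} _ = a , refl

infix 7 _≟ᵇ_
_≟ᵇ_ : ∀ {k} → Fin k → Fin k → Bool
i ≟ᵇ j = ⌊ i ≟ j ⌋

≟ᵇ-sound : ∀ {k} {i j : Fin k} → i ≟ᵇ j ≡ true → i ≡ j
≟ᵇ-sound {i = i} {j} e with i ≟ j
... | yes p = p

≟ᵇ-refl : ∀ {k} (i : Fin k) → i ≟ᵇ i ≡ true
≟ᵇ-refl i with i ≟ i
... | yes _ = refl
... | no i≢i = ⊥-elim (i≢i refl)

≟ᵇ-≢ : ∀ {k} {i j : Fin k} → i ≢ j → i ≟ᵇ j ≡ false
≟ᵇ-≢ {i = i} {j} i≢j with i ≟ j
... | yes p = ⊥-elim (i≢j p)
... | no _ = refl

≟ᵇ-transport : ∀ {n m} (f : Fin n → Fin m) (g : Fin m → Fin n) →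
               (∀ x → g (f x) ≡ x) → (∀ y → f (g y) ≡ y) →
               ∀ x a → f x ≟ᵇ a ≡ x ≟ᵇ g a
≟ᵇ-transport f g gf fg x a with x ≟ g a
... | yes refl rewrite fg a = ≟ᵇ-refl a
... | no x≢ga with f x ≟ a
...   | yes refl = ⊥-elim (x≢ga (sym (gf x)))
...   | no _ = refl

infix 7 _<ᶠ_ _≤ᶠ_
_<ᶠ_ : ∀ {k} → Fin k → Fin k → Bool
i <ᶠ j = toℕ i <ᵇ toℕ j

_≤ᶠ_ : ∀ {k} → Fin k → Fin k → Bool
i ≤ᶠ j = toℕ i ≤ᵇ toℕ j

<ᶠ-sound : ∀ {k} {i j : Fin k} → i <ᶠ j ≡ true → toℕ i < toℕ j
<ᶠ-sound {i = i} {j} e = ℕₚ.<ᵇ⇒< (toℕ i) (toℕ j) (≡true⇒T e)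

<ᶠ-complete : ∀ {k} {i j : Fin k} → toℕ i < toℕ j → i <ᶠ j ≡ true
<ᶠ-complete lt = T⇒≡true (ℕₚ.<⇒<ᵇ lt)

≤ᶠ-complete : ∀ {k} {i j : Fin k} → toℕ i ≤ toℕ j → i ≤ᶠ j ≡ true
≤ᶠ-complete le = T⇒≡true (ℕₚ.≤⇒≤ᵇ le)

allᶠ : ∀ {k} → (Fin k → Bool) → Bool
allᶠ {zero} p = true
allᶠ {suc k} p = p Fin.zero ∧ allᶠ (λ x → p (Fin.suc x))

allᶠ-sound : ∀ {k} (p : Fin k → Bool) → allᶠ p ≡ true → ∀ x → p x ≡ true
allᶠ-sound p e Fin.zero = ∧-elimˡ e
allᶠ-sound p e (Fin.suc x) = allᶠ-sound (λ x → p (Fin.suc x)) (∧-elimʳ {p Fin.zero} e) x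

anyᶠ : ∀ {k} → (Fin k → Bool) → Bool
anyᶠ {zero} p = false
anyᶠ {suc k} p = p Fin.zero ∨ anyᶠ (λ x → p (Fin.suc x))

anyᶠ-sound : ∀ {k} (p : Fin k → Bool) → anyᶠ p ≡ true → ∃ λ x → p x ≡ true
anyᶠ-sound {suc k} p e with p Fin.zero in e₀
... | true = Fin.zero , e₀
... | false with anyᶠ-sound (λ x → p (Fin.suc x)) e
...   | x , eₓ = Fin.suc x , eₓ

anyᶠ-complete : ∀ {k} (p : Fin k → Bool) x → p x ≡ true → anyᶠ p ≡ true
anyᶠ-complete p Fin.zero e rewrite e = refl
anyᶠ-complete {suc k} p (Fin.suc x) e with p Fin.zero
... | true = refl
... | false = anyᶠ-complete (λ x → p (Fin.suc x)) x e

anyᴸ : ∀ {A : Set} → List A → (A → Bool) → Bool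
anyᴸ [] p = false
anyᴸ (x ∷ xs) p = p x ∨ anyᴸ xs p

anyᴸ-sound : ∀ {A : Set} (xs : List A) (p : A → Bool) → anyᴸ xs p ≡ true → ∃ λ x → p x ≡ true
anyᴸ-sound (x ∷ xs) p e with p x in eₓ
... | true = x , eₓ
... | false = anyᴸ-sound xs p e

firstBelow : ∀ m (p : ℕ → Bool) →
  (∃ λ h → h < m × p h ≡ true × (∀ q → q < h → p q ≡ false)) ⊎ (∀ q → q < m → p q ≡ false)
firstBelow zero p = inj₂ (λ q ())
firstBelow (suc m) p with firstBelow m p
... | inj₁ (h , h<m , ph , before) = inj₁ (h , m<n⇒m<1+n h<m , ph , before)
... | inj₂ none with p m in pm
...   | true = inj₁ (m , n<1+n m , pm , none)
...   | false = inj₂ none′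
  where
  none′ : ∀ q → q < suc m → p q ≡ false
  none′ q q<1+m with m<1+n⇒m<n∨m≡n q<1+m
  ... | inj₁ q<m = none q q<m
  ... | inj₂ refl = pm

reach-trans : ∀ {n} {R : Adj n} {x y z} → Reach R x y → Reach R y z → Reach R x z
reach-trans here q = q
reach-trans (step e p) q = step e (reach-trans p q)

reach-snoc : ∀ {n} {R : Adj n} {x y z} → Reach R x y → R y z ≡ true → Reach R x z
reach-snoc p e = reach-trans p (step e here)

reach-flip : ∀ {n} {R : Adj n} {x y} → Reach R x y → Reach (flip R) y x
reach-flip here = here
reach-flip (step e p) = reach-snoc (reach-flip p) e

Preserves : ∀ {n m} → (Fin n → Fin m) → Adj n → Adj m → Set
Preserves f R S = ∀ u v → R u v ≡ true → S (f u) (f v) ≡ true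

reach-map : ∀ {n m} {R : Adj n} {S : Adj m} (f : Fin n → Fin m) → Preserves f R S →
            ∀ {x y} → Reach R x y → Reach S (f x) (f y)
reach-map f pres here = here
reach-map f pres (step {u} {v} e p) = step (pres u v e) (reach-map f pres p)

reach-mono : ∀ {n} {R S : Adj n} → Preserves (λ x → x) R S → ∀ {x y} → Reach R x y → Reach S x y
reach-mono = reach-map (λ x → x)

noArcsInto⇒¬Reach : ∀ {n} (R : Adj n) v → (∀ y → R y v ≡ false) → ∀ {x} → x ≢ v → ¬ Reach R x v
noArcsInto⇒¬Reach R v none x≢v here = x≢v refl
noArcsInto⇒¬Reach R v none x≢v (step {x} {z} e p) with z ≟ v
... | yes refl = false≢true (trans (sym (none x)) e)
... | no z≢v = noArcsInto⇒¬Reach R v none z≢v p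

noArcsOutOf⇒¬Reach : ∀ {n} (R : Adj n) v → (∀ y → R v y ≡ false) → ∀ {x} → x ≢ v → ¬ Reach R v x
noArcsOutOf⇒¬Reach R v none x≢v here = x≢v refl
noArcsOutOf⇒¬Reach R v none x≢v (step {v = z} e p) = false≢true (trans (sym (none z)) e)

StronglyConnected-transport : ∀ {n m} {R : Adj n} {S : Adj m} (f : Fin n → Fin m) (g : Fin m → Fin n) →
  (∀ y → f (g y) ≡ y) → Preserves f R S → StronglyConnected R → StronglyConnected S
StronglyConnected-transport {S = S} f g fg pres sc x y =
  subst₂ (Reach S) (fg x) (fg y) (reach-map f pres (sc (g x) (g y)))

removeEdge-sym : ∀ {n} (R : Adj n) u v → Preserves (λ x → x) (removeEdge R v u) (removeEdge R u v)
removeEdge-sym R u v x y e =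
  trans (cong (λ c → R x y ∧ not c) (∨-comm (x ≟ᵇ u ∧ y ≟ᵇ v) (x ≟ᵇ v ∧ y ≟ᵇ u))) e

removeEdge-removes : ∀ {n} (R : Adj n) u v → removeEdge R u v u v ≡ false
removeEdge-removes R u v rewrite ≟ᵇ-refl u | ≟ᵇ-refl v = ∧-zeroʳ (R u v)

removeEdge-removes-reverse : ∀ {n} (R : Adj n) u v → removeEdge R u v v u ≡ false
removeEdge-removes-reverse R u v rewrite ≟ᵇ-refl u | ≟ᵇ-refl v =
  trans (cong (λ c → R v u ∧ not c) (∨-zeroʳ (v ≟ᵇ u ∧ u ≟ᵇ v))) (∧-zeroʳ (R v u))

removeEdge-only : ∀ {n} (R : Adj n) u v x y → (R x y ≡ true → (x ≡ u × y ≡ v) ⊎ (x ≡ v × y ≡ u)) →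
                  removeEdge R u v x y ≡ false
removeEdge-only R u v x y only with R x y
... | false = refl
... | true with only refl
...   | inj₁ (refl , refl) rewrite ≟ᵇ-refl x | ≟ᵇ-refl y = refl
...   | inj₂ (refl , refl) rewrite ≟ᵇ-refl x | ≟ᵇ-refl y = cong not (∨-zeroʳ (x ≟ᵇ y ∧ y ≟ᵇ x))

removeEdge-false : ∀ {n} (R : Adj n) u v x z → R x z ≡ true → removeEdge R u v x z ≡ false →
                   (x ≡ u × z ≡ v) ⊎ (x ≡ v × z ≡ u)
removeEdge-false R u v x z rxz removed rewrite rxz with ∨-elim {x ≟ᵇ u ∧ z ≟ᵇ v} (not-false removed)
... | inj₁ e = inj₁ (≟ᵇ-sound (∧-elimˡ e) , ≟ᵇ-sound (∧-elimʳ {x ≟ᵇ u} e))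
... | inj₂ e = inj₂ (≟ᵇ-sound (∧-elimˡ e) , ≟ᵇ-sound (∧-elimʳ {x ≟ᵇ v} e))

removeEdge-preserves : ∀ {n m} {R : Adj n} {S : Adj m} (f : Fin n → Fin m) (g : Fin m → Fin n) →
  (∀ x → g (f x) ≡ x) → (∀ y → f (g y) ≡ y) → Preserves f R S →
  ∀ a b → Preserves f (removeEdge R (g a) (g b)) (removeEdge S a b)
removeEdge-preserves {R = R} f g gf fg pres a b u v e
  rewrite ≟ᵇ-transport f g gf fg u a | ≟ᵇ-transport f g gf fg v b
        | ≟ᵇ-transport f g gf fg u b | ≟ᵇ-transport f g gf fg v a
  = ∧-intro (pres u v (∧-elimˡ e)) (∧-elimʳ {R u v} e)

-- A path a → b avoiding the arc (a , b) replaces that arc in every path.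
removeEdge-reroute : ∀ {n} (R : Adj n) u v a b → R b a ≡ false →
  (a ≡ u × b ≡ v) ⊎ (a ≡ v × b ≡ u) → Reach (removeEdge R u v) a b →
  ∀ {x y} → Reach R x y → Reach (removeEdge R u v) x y
removeEdge-reroute R u v a b rba ab bypass here = here
removeEdge-reroute R u v a b rba ab bypass (step {x} {z} e p) with removeEdge R u v x z in kept
... | true = step kept (removeEdge-reroute R u v a b rba ab bypass p)
... | false with removeEdge-false R u v x z e kept | ab
...   | inj₁ (refl , refl) | inj₁ (refl , refl) = reach-trans bypass (removeEdge-reroute R u v a b rba ab bypass p)
...   | inj₂ (refl , refl) | inj₂ (refl , refl) = reach-trans bypass (removeEdge-reroute R u v a b rba ab bypass p)
...   | inj₁ (refl , refl) | inj₂ (refl , refl) = ⊥-elim (false≢true (trans (sym rba) e))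
...   | inj₂ (refl , refl) | inj₁ (refl , refl) = ⊥-elim (false≢true (trans (sym rba) e))

-- Vertices of degree three

record Neighbours₃ {n} (G : Adj n) (v : Fin n) : Set where
  constructor neighbours₃
  field
    a b c : Fin n
    a≢b : a ≢ b
    a≢c : a ≢ c
    b≢c : b ≢ c
    edge-a : G v a ≡ true
    edge-b : G v b ≡ true
    edge-c : G v c ≡ true
    only : ∀ y → G v y ≡ true → y ≡ a ⊎ y ≡ b ⊎ y ≡ c

degree3⇒Neighbours₃ : ∀ {n} (G : Adj n) v → degree G v ≡ 3 → Neighbours₃ G v
degree3⇒Neighbours₃ {n} G v deg = fromList (filterᵇ (G v) (allFin n)) refl deg
  (filter⁺ (λ x → T? (G v x)) (allFin⁺ n))
  where
  member⇒edge : ∀ {L} → filterᵇ (G v) (allFin n) ≡ L → ∀ {x} → x ∈ L → G v x ≡ true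
  member⇒edge refl m = T⇒≡true (proj₂ (∈-filter⁻ (λ x → T? (G v x)) {xs = allFin n} m))
  edge⇒member : ∀ {L} → filterᵇ (G v) (allFin n) ≡ L → ∀ x → G v x ≡ true → x ∈ L
  edge⇒member refl x e = ∈-filter⁺ (λ x → T? (G v x)) (∈-allFin x) (≡true⇒T e)
  fromList : (L : List (Fin n)) → filterᵇ (G v) (allFin n) ≡ L → length L ≡ 3 → Unique L → Neighbours₃ G v
  fromList (a ∷ b ∷ c ∷ []) eq _ ((a≢b ∷ a≢c ∷ []) ∷ (b≢c ∷ []) ∷ [] ∷ []) =
    neighbours₃ a b c a≢b a≢c b≢c
      (member⇒edge eq (here refl)) (member⇒edge eq (there (here refl)))
      (member⇒edge eq (there (there (here refl))))
      (λ y e → which (edge⇒member eq y e))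
    where
    which : ∀ {y} → y ∈ (a ∷ b ∷ c ∷ []) → y ≡ a ⊎ y ≡ b ⊎ y ≡ c
    which (here p) = inj₁ p
    which (there (here p)) = inj₂ (inj₁ p)
    which (there (there (here p))) = inj₂ (inj₂ p)

unique-lookup : ∀ {A : Set} {L : List A} → Unique L → ∀ {i j} → i Fin.< j → List.lookup L i ≢ List.lookup L j
unique-lookup (x∉ ∷ u) {Fin.zero} {Fin.suc j} _ = All.lookup x∉ (∈-lookup j)
unique-lookup (_ ∷ u) {Fin.suc i} {Fin.suc j} (s≤s i<j) = unique-lookup u i<j

module _ {n} {G : Adj n} {v : Fin n} (N : Neighbours₃ G v) where
  open Neighbours₃ N

  neighbourIndex : ∀ y → G v y ≡ true → Fin 3
  neighbourIndex y e with only y e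
  ... | inj₁ _ = 0F
  ... | inj₂ (inj₁ _) = 1F
  ... | inj₂ (inj₂ _) = Fin.suc 1F

  neighbourIndex-injective : ∀ y z e f → neighbourIndex y e ≡ neighbourIndex z f → y ≡ z
  neighbourIndex-injective y z e f same with only y e | only z f
  ... | inj₁ refl | inj₁ refl = refl
  ... | inj₂ (inj₁ refl) | inj₂ (inj₁ refl) = refl
  ... | inj₂ (inj₂ refl) | inj₂ (inj₂ refl) = refl
  neighbourIndex-injective y z e f () | inj₁ _ | inj₂ (inj₁ _)
  neighbourIndex-injective y z e f () | inj₁ _ | inj₂ (inj₂ _)
  neighbourIndex-injective y z e f () | inj₂ (inj₁ _) | inj₁ _
  neighbourIndex-injective y z e f () | inj₂ (inj₁ _) | inj₂ (inj₂ _)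
  neighbourIndex-injective y z e f () | inj₂ (inj₂ _) | inj₁ _
  neighbourIndex-injective y z e f () | inj₂ (inj₂ _) | inj₂ (inj₁ _)

  Neighbours₃-length≤3 : (L : List (Fin n)) → Unique L → (∀ {x} → x ∈ L → G v x ≡ true) → length L ≤ 3
  Neighbours₃-length≤3 L u adjacent with 4 ≤? length L
  ... | no 4≰ = ℕₚ.≤-pred (≰⇒> 4≰)
  ... | yes 4≤ with pigeonhole (ℕₚ.n<1+n 3) (λ i → neighbourIndex (x i) (adjacent (∈-lookup (inject≤ i 4≤))))
    where
    x : Fin 4 → Fin n
    x i = List.lookup L (inject≤ i 4≤)
  ...   | i , j , i<j , same = ⊥-elim (unique-lookup u inject-< (neighbourIndex-injective _ _ _ _ same))
    where
    inject-< : inject≤ i 4≤ Fin.< inject≤ j 4≤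
    inject-< = subst₂ ℕ._<_ (sym (toℕ-inject≤ i 4≤)) (sym (toℕ-inject≤ j 4≤)) i<j

two-of-three-equal : ∀ (x y z : Bool) → y ≡ z ⊎ x ≡ z ⊎ x ≡ y
two-of-three-equal true true _ = inj₂ (inj₂ refl)
two-of-three-equal false false _ = inj₂ (inj₂ refl)
two-of-three-equal true false true = inj₂ (inj₁ refl)
two-of-three-equal false true false = inj₂ (inj₁ refl)
two-of-three-equal true false false = inj₁ refl
two-of-three-equal false true true = inj₁ refl

module _ {n} {G : Adj n} (simple : IsSimple G) {v : Fin n} (N : Neighbours₃ G v) where
  open IsSimple simple
  open Neighbours₃ N

  ¬Covers-0 : ¬ Covers G 0
  ¬Covers-0 (Os , covered) with covered v a edge-a
  ... | () , _

  edge-≢ : ∀ {w} → G v w ≡ true → w ≢ v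
  edge-≢ {w} gw refl = false≢true (trans (sym (irrefl w)) gw)

  AlignedExcept : Orientation G → Fin n → Bool → Set
  AlignedExcept O w t = ∀ y → G v y ≡ true → y ≢ w → arc O v y ≡ t

  -- Deleting the one edge at v that breaks the alignment leaves v a source or a sink.
  aligned⇒¬Deletable : (O : Orientation G) → ∀ w t → G v w ≡ true → AlignedExcept O w t → ¬ Deletable O v w
  aligned⇒¬Deletable O w true gw aligned d =
    noArcsInto⇒¬Reach (removeEdge (arc O) v w) v noIn (edge-≢ gw) (d w v)
    where
    noIn : ∀ y → removeEdge (arc O) v w y v ≡ false
    noIn y = removeEdge-only (arc O) v w y v λ e → inj₂ (y≡w e , refl)
      where
      y≡w : arc O y v ≡ true → y ≡ w
      y≡w e with y ≟ w
      ... | yes y≡w = y≡w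
      ... | no y≢w = ⊥-elim (false≢true (trans (sym reversed) e))
        where
        reversed : arc O y v ≡ false
        reversed = trans (exactlyOne O y v (onEdges O y v e))
                         (cong not (aligned y (trans (symm v y) (onEdges O y v e)) y≢w))
  aligned⇒¬Deletable O w false gw aligned d =
    noArcsOutOf⇒¬Reach (removeEdge (arc O) v w) v noOut (edge-≢ gw) (d v w)
    where
    noOut : ∀ y → removeEdge (arc O) v w v y ≡ false
    noOut y = removeEdge-only (arc O) v w v y λ e → inj₁ (refl , y≡w e)
      where
      y≡w : arc O v y ≡ true → y ≡ w
      y≡w e with y ≟ w
      ... | yes y≡w = y≡w
      ... | no y≢w = ⊥-elim (false≢true (trans (sym (aligned y (onEdges O v y e) y≢w)) e))

  some-edge-aligned : (O : Orientation G) → ∃₂ λ w t → G v w ≡ true × AlignedExcept O w t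
  some-edge-aligned O with two-of-three-equal (arc O v a) (arc O v b) (arc O v c)
  ... | inj₁ b≡c = a , arc O v b , edge-a , aligned
    where
    aligned : AlignedExcept O a (arc O v b)
    aligned y gy y≢a with only y gy
    ... | inj₁ refl = ⊥-elim (y≢a refl)
    ... | inj₂ (inj₁ refl) = refl
    ... | inj₂ (inj₂ refl) = sym b≡c
  ... | inj₂ (inj₁ a≡c) = b , arc O v a , edge-b , aligned
    where
    aligned : AlignedExcept O b (arc O v a)
    aligned y gy y≢b with only y gy
    ... | inj₁ refl = refl
    ... | inj₂ (inj₁ refl) = ⊥-elim (y≢b refl)
    ... | inj₂ (inj₂ refl) = sym a≡c
  ... | inj₂ (inj₂ a≡b) = c , arc O v a , edge-c , aligned
    where
    aligned : AlignedExcept O c (arc O v a)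
    aligned y gy y≢c with only y gy
    ... | inj₁ refl = refl
    ... | inj₂ (inj₁ refl) = sym a≡b
    ... | inj₂ (inj₂ refl) = ⊥-elim (y≢c refl)

  ¬Covers-1 : ¬ Covers G 1
  ¬Covers-1 (Os , covered) with some-edge-aligned (Os 0F)
  ... | w , t , gw , aligned with covered v w gw
  ...   | 0F , d = aligned⇒¬Deletable (Os 0F) w t gw aligned d

  ¬Covers-<2 : ∀ k → k < 2 → ¬ Covers G k
  ¬Covers-<2 0 _ = ¬Covers-0
  ¬Covers-<2 1 _ = ¬Covers-1
  ¬Covers-<2 (suc (suc k)) (s≤s (s≤s ()))

mkIsomorphic : ∀ {n m} {G : Adj n} {H : Adj m} (f : Fin n → Fin m) (g : Fin m → Fin n) →
  (∀ x → g (f x) ≡ x) → (∀ y → f (g y) ≡ y) → (∀ u v → G u v ≡ H (f u) (f v)) → Isomorphic G H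
mkIsomorphic f g gf fg pres = mk↔ₛ′ f g fg gf , pres

module _ {n m} {G : Adj n} {H : Adj m} (iso : Isomorphic G H) where
  private
    f : Fin n → Fin m
    f = Inverse.to (proj₁ iso)
    g : Fin m → Fin n
    g = Inverse.from (proj₁ iso)
    gf : ∀ x → g (f x) ≡ x
    gf = Inverse.strictlyInverseʳ (proj₁ iso)
    fg : ∀ y → f (g y) ≡ y
    fg = Inverse.strictlyInverseˡ (proj₁ iso)
    adjacent : Preserves f G H
    adjacent u v e = trans (sym (proj₂ iso u v)) e

  Isomorphic-reflect : ∀ a b → H a b ≡ G (g a) (g b)
  Isomorphic-reflect a b = trans (cong₂ H (sym (fg a)) (sym (fg b))) (sym (proj₂ iso (g a) (g b)))

  Isomorphic-sym : Isomorphic H G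
  Isomorphic-sym = ↔-sym (proj₁ iso) , Isomorphic-reflect

  IsSimple-reflect : IsSimple H → IsSimple G
  IsSimple-reflect simple = record
    { symm = λ u v → trans (proj₂ iso u v) (trans (IsSimple.symm simple (f u) (f v)) (sym (proj₂ iso v u)))
    ; irrefl = λ u → trans (proj₂ iso u u) (IsSimple.irrefl simple (f u)) }

  Neighbours₃-reflect : ∀ v → Neighbours₃ H (f v) → Neighbours₃ G v
  Neighbours₃-reflect v (neighbours₃ a b c a≢b a≢c b≢c ea eb ec only) =
    neighbours₃ (g a) (g b) (g c)
      (λ e → a≢b (trans (sym (fg a)) (trans (cong f e) (fg b))))
      (λ e → a≢c (trans (sym (fg a)) (trans (cong f e) (fg c))))
      (λ e → b≢c (trans (sym (fg b)) (trans (cong f e) (fg c))))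
      (edge ea) (edge eb) (edge ec)
      (λ y e → which (only (f y) (trans (sym (proj₂ iso v y)) e)))
    where
    edge : ∀ {x} → H (f v) x ≡ true → G v (g x) ≡ true
    edge {x} e = trans (proj₂ iso v (g x)) (subst (λ z → H (f v) z ≡ true) (sym (fg x)) e)
    back : ∀ {y x} → f y ≡ x → y ≡ g x
    back {y} refl = sym (gf y)
    which : ∀ {y} → f y ≡ a ⊎ f y ≡ b ⊎ f y ≡ c → y ≡ g a ⊎ y ≡ g b ⊎ y ≡ g c
    which (inj₁ e) = inj₁ (back e)
    which (inj₂ (inj₁ e)) = inj₂ (inj₁ (back e))
    which (inj₂ (inj₂ e)) = inj₂ (inj₂ (back e))

  removeEdge²-StronglyConnected-transport :
    (∀ a b c d → StronglyConnected (removeEdge (removeEdge G a b) c d)) →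
    ∀ a b c d → StronglyConnected (removeEdge (removeEdge H a b) c d)
  removeEdge²-StronglyConnected-transport sc a b c d =
    StronglyConnected-transport f g fg
      (removeEdge-preserves {R = removeEdge G (g a) (g b)} {S = removeEdge H a b} f g gf fg
        (removeEdge-preserves {R = G} {S = H} f g gf fg adjacent a b) c d)
      (sc (g a) (g b) (g c) (g d))

  orientation-transport : Orientation G → Orientation H
  orientation-transport O = record
    { arc = λ a b → arc O (g a) (g b)
    ; onEdges = λ a b e → trans (Isomorphic-reflect a b) (onEdges O (g a) (g b) e)
    ; exactlyOne = λ a b e → exactlyOne O (g a) (g b) (trans (sym (Isomorphic-reflect a b)) e) }

  Deletable-transport : (O : Orientation G) → ∀ a b → Deletable O (g a) (g b) →
                        Deletable (orientation-transport O) a b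
  Deletable-transport O a b = StronglyConnected-transport f g fg
    (removeEdge-preserves {S = arc (orientation-transport O)} f g gf fg arcs a b)
    where
    arcs : Preserves f (arc O) (arc (orientation-transport O))
    arcs u v e rewrite gf u | gf v = e

  Covers-transport : ∀ {k} → Covers G k → Covers H k
  Covers-transport (Os , covered) =
    (λ i → orientation-transport (Os i)) , λ a b e →
      let (i , d) = covered (g a) (g b) (trans (sym (Isomorphic-reflect a b)) e)
      in i , Deletable-transport (Os i) a b d

Isomorphic-trans : ∀ {n m l} {G : Adj n} {H : Adj m} {K : Adj l} →
                   Isomorphic G H → Isomorphic H K → Isomorphic G K
Isomorphic-trans (f , p) (g , q) =
  ↔-trans f g , λ u v → trans (p u v) (q (Inverse.to f u) (Inverse.to f v))

reverse : ∀ {n} {G : Adj n} → IsSimple G → Orientation G → Orientation G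
reverse simple O = record
  { arc = λ u v → arc O v u
  ; onEdges = λ u v e → trans (IsSimple.symm simple u v) (onEdges O v u e)
  ; exactlyOne = λ u v e → exactlyOne O v u (trans (IsSimple.symm simple v u) e) }

reverse-Deletable : ∀ {n} {G : Adj n} (simple : IsSimple G) O u v → Deletable O u v → Deletable (reverse simple O) u v
reverse-Deletable simple O u v d x y = reach-mono same (reach-flip (d y x))
  where
  same : Preserves (λ x → x) (flip (removeEdge (arc O) u v)) (removeEdge (arc (reverse simple O)) u v)
  same a b e rewrite ∧-comm (b ≟ᵇ u) (a ≟ᵇ v) | ∧-comm (b ≟ᵇ v) (a ≟ᵇ u)
    = trans (cong (λ c → arc O b a ∧ not c) (∨-comm (a ≟ᵇ u ∧ b ≟ᵇ v) (a ≟ᵇ v ∧ b ≟ᵇ u))) e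

reverseIf : ∀ {n} {G : Adj n} → IsSimple G → Bool → Orientation G → Orientation G
reverseIf simple true O = reverse simple O
reverseIf simple false O = O

reverseIf-Deletable : ∀ {n} {G : Adj n} (simple : IsSimple G) r O u v → Deletable O u v → Deletable (reverseIf simple r O) u v
reverseIf-Deletable simple true O u v d = reverse-Deletable simple O u v d
reverseIf-Deletable simple false O u v d = d

-- Breadth-first normal form

module BreadthFirst {n : ℕ} (G : Adj n) (simple : IsSimple G) (connected : Connected G) (s : Fin n) where
  open IsSimple simple

  Labelling : Set
  Labelling = ℕ → Fin n

  labelled : ℕ → Labelling → Fin n → Bool
  labelled zero ψ w = false
  labelled (suc m) ψ w = labelled m ψ w ∨ ψ m ≟ᵇ w

  labelled-complete : ∀ m (ψ : Labelling) i → i < m → labelled m ψ (ψ i) ≡ true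
  labelled-complete (suc m) ψ i i<1+m with m<1+n⇒m<n∨m≡n i<1+m
  ... | inj₁ i<m rewrite labelled-complete m ψ i i<m = refl
  ... | inj₂ refl rewrite ≟ᵇ-refl (ψ m) = ∨-zeroʳ _

  labelled-sound : ∀ m (ψ : Labelling) w → labelled m ψ w ≡ true → ∃ λ i → i < m × ψ i ≡ w
  labelled-sound (suc m) ψ w e with ∨-elim {labelled m ψ w} e
  ... | inj₁ earlier = let (i , i<m , ψi≡w) = labelled-sound m ψ w earlier in i , m<n⇒m<1+n i<m , ψi≡w
  ... | inj₂ last = m , n<1+n m , ≟ᵇ-sound last

  labelled-cong : ∀ m (ψ χ : Labelling) → (∀ i → i < m → χ i ≡ ψ i) → ∀ w → labelled m χ w ≡ labelled m ψ w
  labelled-cong zero ψ χ agree w = refl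
  labelled-cong (suc m) ψ χ agree w
    rewrite labelled-cong m ψ χ (λ i i<m → agree i (m<n⇒m<1+n i<m)) w | agree m (n<1+n m) = refl

  unlabelledNeighbour : ℕ → Labelling → ℕ → Fin n → Bool
  unlabelledNeighbour m ψ q w = G (ψ q) w ∧ not (labelled m ψ w)

  hasUnlabelledNeighbour : ℕ → Labelling → ℕ → Bool
  hasUnlabelledNeighbour m ψ q = anyᶠ (unlabelledNeighbour m ψ q)

  -- ψ 0 … ψ (m ∸ 1) start a breadth-first search from s: each later vertex has an earlier
  -- neighbour, and first neighbours come in order.  frontier is the auxiliary invariant
  -- that survives labelling one more vertex.
  record BFSPrefix (m : ℕ) (ψ : Labelling) : Set where
    field
      nonempty : 0 < m
      root : ψ 0 ≡ s
      injective : ∀ i j → i < m → j < m → ψ i ≡ ψ j → i ≡ j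
      parent : ∀ j → 0 < j → j < m → ∃ λ p → p < j × G (ψ p) (ψ j) ≡ true
      parent-monotone : ∀ j j′ q → 0 < j → j < j′ → j′ < m → q < m → G (ψ q) (ψ j′) ≡ true →
                        ∃ λ p → p ≤ q × G (ψ p) (ψ j) ≡ true
      frontier : ∀ j q → 0 < j → j < m → q < m → hasUnlabelledNeighbour m ψ q ≡ true →
                 ∃ λ p → p ≤ q × G (ψ p) (ψ j) ≡ true

  root-prefix : BFSPrefix 1 (λ _ → s)
  root-prefix = record
    { nonempty = s≤s z≤n ; root = refl
    ; injective = λ { zero zero _ _ _ → refl ; (suc i) _ (s≤s ()) _ _ ; zero (suc j) _ (s≤s ()) _ }
    ; parent = λ { zero () _ ; (suc j) _ (s≤s ()) }
    ; parent-monotone = λ { j (suc j′) q _ _ (s≤s ()) _ _ ; zero zero q () _ _ _ _ ; (suc _) zero _ _ () _ _ _ }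
    ; frontier = λ { zero q () _ _ _ ; (suc j) q _ (s≤s ()) _ _ } }

  extend : Labelling → ℕ → Fin n → Labelling
  extend ψ m w i = if i ℕ.≡ᵇ m then w else ψ i

  extend-old : ∀ (ψ : Labelling) m w i → i < m → extend ψ m w i ≡ ψ i
  extend-old ψ m w i i<m with i ℕ.≡ᵇ m in e
  ... | false = refl
  ... | true = ⊥-elim (<-irrefl (ℕₚ.≡ᵇ⇒≡ i m (≡true⇒T e)) i<m)

  extend-new : ∀ (ψ : Labelling) m w → extend ψ m w m ≡ w
  extend-new ψ m w rewrite T⇒≡true (ℕₚ.≡⇒≡ᵇ m m refl) = refl

  hasUnlabelledNeighbour-extend : ∀ m (ψ : Labelling) w q → q < m →
    hasUnlabelledNeighbour (suc m) (extend ψ m w) q ≡ true → hasUnlabelledNeighbour m ψ q ≡ true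
  hasUnlabelledNeighbour-extend m ψ w q q<m e =
    let (x , ex) = anyᶠ-sound (unlabelledNeighbour (suc m) (extend ψ m w) q) e
        edge = subst (λ z → G z x ≡ true) (extend-old ψ m w q q<m) (∧-elimˡ ex)
        new = not-true (∧-elimʳ {G (extend ψ m w q) x} ex)
    in anyᶠ-complete (unlabelledNeighbour m ψ q) x (∧-intro edge (cong not (still-new new)))
    where
    still-new : ∀ {x} → labelled (suc m) (extend ψ m w) x ≡ false → labelled m ψ x ≡ false
    still-new {x} e′ with labelled m ψ x in old
    ... | false = refl
    ... | true rewrite labelled-cong m ψ (extend ψ m w) (extend-old ψ m w) x | old = e′

  module Extend (m : ℕ) (ψ : Labelling) (P : BFSPrefix m ψ) (h : ℕ) (h<m : h < m)
                (first : ∀ q → q < h → hasUnlabelledNeighbour m ψ q ≡ false)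
                (w : Fin n) (hw : G (ψ h) w ≡ true) (w-new : labelled m ψ w ≡ false) where
    open BFSPrefix P

    ψ′ : Labelling
    ψ′ = extend ψ m w

    old : ∀ i → i < m → ψ′ i ≡ ψ i
    old = extend-old ψ m w

    new : ψ′ m ≡ w
    new = extend-new ψ m w

    adjacent : ∀ {a b a′ b′} → a′ ≡ a → b′ ≡ b → G a b ≡ true → G a′ b′ ≡ true
    adjacent refl refl e = e

    w-witness : ∀ q → q < m → G (ψ q) w ≡ true → hasUnlabelledNeighbour m ψ q ≡ true
    w-witness q q<m e = anyᶠ-complete (unlabelledNeighbour m ψ q) w (∧-intro e (cong not w-new))

    w-fresh : ∀ i → i < m → ψ i ≢ w
    w-fresh i i<m ψi≡w =
      false≢true (trans (sym w-new) (subst (λ x → labelled m ψ x ≡ true) ψi≡w (labelled-complete m ψ i i<m)))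

    injective′ : ∀ i j → i < suc m → j < suc m → ψ′ i ≡ ψ′ j → i ≡ j
    injective′ i j i< j< eq with m<1+n⇒m<n∨m≡n i< | m<1+n⇒m<n∨m≡n j<
    ... | inj₁ i<m | inj₁ j<m = injective i j i<m j<m (trans (sym (old i i<m)) (trans eq (old j j<m)))
    ... | inj₁ i<m | inj₂ refl = ⊥-elim (w-fresh i i<m (trans (sym (old i i<m)) (trans eq new)))
    ... | inj₂ refl | inj₁ j<m = ⊥-elim (w-fresh j j<m (trans (sym (old j j<m)) (trans (sym eq) new)))
    ... | inj₂ refl | inj₂ refl = refl

    parent′ : ∀ j → 0 < j → j < suc m → ∃ λ p → p < j × G (ψ′ p) (ψ′ j) ≡ true
    parent′ j 0<j j< with m<1+n⇒m<n∨m≡n j<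
    ... | inj₁ j<m = let (p , p<j , e) = parent j 0<j j<m in
          p , p<j , adjacent (old p (<-trans p<j j<m)) (old j j<m) e
    ... | inj₂ refl = h , h<m , adjacent (old h h<m) new hw

    parent-monotone′ : ∀ j j′ q → 0 < j → j < j′ → j′ < suc m → q < suc m → G (ψ′ q) (ψ′ j′) ≡ true →
                       ∃ λ p → p ≤ q × G (ψ′ p) (ψ′ j) ≡ true
    parent-monotone′ j j′ q 0<j j<j′ j′< q< e with m<1+n⇒m<n∨m≡n j′< | m<1+n⇒m<n∨m≡n q<
    ... | inj₁ j′<m | inj₁ q<m =
          let (p , p≤q , e′) = parent-monotone j j′ q 0<j j<j′ j′<m q<m (adjacent (sym (old q q<m)) (sym (old j′ j′<m)) e)
          in p , p≤q , adjacent (old p (≤-<-trans p≤q q<m)) (old j (<-trans j<j′ j′<m)) e′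
    ... | inj₁ j′<m | inj₂ refl =
          let j<m = <-trans j<j′ j′<m
              (p , p<j , e′) = parent j 0<j j<m
              p<m = <-trans p<j j<m
          in p , <⇒≤ p<m , adjacent (old p p<m) (old j j<m) e′
    ... | inj₂ refl | inj₁ q<m =
          let (p , p≤q , e′) = frontier j q 0<j j<j′ q<m (w-witness q q<m (adjacent (sym (old q q<m)) (sym new) e))
          in p , p≤q , adjacent (old p (≤-<-trans p≤q q<m)) (old j j<j′) e′
    ... | inj₂ refl | inj₂ refl = ⊥-elim (false≢true (trans (sym (irrefl (ψ′ j′))) e))

    frontier′ : ∀ j q → 0 < j → j < suc m → q < suc m → hasUnlabelledNeighbour (suc m) ψ′ q ≡ true →
                ∃ λ p → p ≤ q × G (ψ′ p) (ψ′ j) ≡ true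
    frontier′ j q 0<j j< q< more with m<1+n⇒m<n∨m≡n q<
    ... | inj₂ refl = let (p , p<j , e) = parent′ j 0<j j< in p , ≤-trans (<⇒≤ p<j) (ℕₚ.≤-pred j<) , e
    ... | inj₁ q<m with hasUnlabelledNeighbour-extend m ψ w q q<m more | m<1+n⇒m<n∨m≡n j<
    ...   | more′ | inj₁ j<m = let (p , p≤q , e) = frontier j q 0<j j<m q<m more′ in
            p , p≤q , adjacent (old p (≤-<-trans p≤q q<m)) (old j j<m) e
    ...   | more′ | inj₂ refl = h , h≤q , adjacent (old h h<m) new hw
      where
      h≤q : h ≤ q
      h≤q with <-cmp q h
      ... | tri< q<h _ _ = ⊥-elim (false≢true (trans (sym (first q q<h)) more′))
      ... | tri≈ _ refl _ = ≤-refl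
      ... | tri> _ _ h<q = <⇒≤ h<q

    prefix : BFSPrefix (suc m) ψ′
    prefix = record
      { nonempty = s≤s z≤n
      ; root = trans (old 0 nonempty) root
      ; injective = injective′
      ; parent = parent′
      ; parent-monotone = parent-monotone′
      ; frontier = frontier′ }

  record BFSLabelling : Set where
    field
      size : ℕ
      label : Labelling
      prefix : BFSPrefix size label
      surjective : ∀ y → ∃ λ i → i < size × label i ≡ y

  injective-prefix⇒≤ : ∀ m (ψ : Labelling) → (∀ i j → i < m → j < m → ψ i ≡ ψ j → i ≡ j) → m ≤ n
  injective-prefix⇒≤ m ψ inj = injective⇒≤ {f = λ (i : Fin m) → ψ (toℕ i)}
    (λ {i} {j} eq → toℕ-injective (inj (toℕ i) (toℕ j) (toℕ<n i) (toℕ<n j) eq))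

  closed⇒reach-labelled : ∀ m (ψ : Labelling) → (∀ q → q < m → hasUnlabelledNeighbour m ψ q ≡ false) →
    ∀ {x y} → labelled m ψ x ≡ true → Reach G x y → labelled m ψ y ≡ true
  closed⇒reach-labelled m ψ closed lx here = lx
  closed⇒reach-labelled m ψ closed {x} lx (step {v = z} e r) with labelled m ψ z in lz
  ... | true = closed⇒reach-labelled m ψ closed lz r
  ... | false =
    let (q , q<m , ψq≡x) = labelled-sound m ψ x lx
        more = anyᶠ-complete (unlabelledNeighbour m ψ q) z
                 (∧-intro (subst (λ a → G a z ≡ true) (sym ψq≡x) e) (cong not lz))
    in ⊥-elim (false≢true (trans (sym (closed q q<m)) more))

  -- Each round labels a new vertex, so n rounds of fuel suffice.
  bfs : ∀ (fuel m : ℕ) (ψ : Labelling) → n < m + fuel → BFSPrefix m ψ → BFSLabelling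
  bfs zero m ψ n<m+0 P = ⊥-elim (<-irrefl refl (≤-<-trans (injective-prefix⇒≤ m ψ (BFSPrefix.injective P))
                                                  (subst (n <_) (ℕₚ.+-identityʳ m) n<m+0)))
  bfs (suc fuel) m ψ bound P with firstBelow m (hasUnlabelledNeighbour m ψ)
  ... | inj₂ closed = record
        { size = m ; label = ψ ; prefix = P
        ; surjective = λ y → labelled-sound m ψ y
            (closed⇒reach-labelled m ψ closed (labelled-complete m ψ 0 (BFSPrefix.nonempty P))
              (subst (λ a → Reach G a y) (sym (BFSPrefix.root P)) (connected s y))) }
  ... | inj₁ (h , h<m , more , first) with anyᶠ-sound (unlabelledNeighbour m ψ h) more
  ...   | w , hw = bfs fuel (suc m) (extend ψ m w) (subst (n <_) (ℕₚ.+-suc m fuel) bound)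
                     (Extend.prefix m ψ P h h<m first w (∧-elimˡ hw) (not-true (∧-elimʳ {G (ψ h) w} hw)))

  breadth-first-labelling : BFSLabelling
  breadth-first-labelling = bfs n 1 (λ _ → s) (s≤s ≤-refl) root-prefix

record BFSNormal {k} (T : Adj k) : Set where
  field
    simple : IsSimple T
    neighbours : ∀ i → Neighbours₃ T i
    parent : ∀ j → 0 < toℕ j → ∃ λ p → toℕ p < toℕ j × T p j ≡ true
    parent-monotone : ∀ j j′ q → 0 < toℕ j → toℕ j < toℕ j′ → T q j′ ≡ true →
                      ∃ λ p → toℕ p ≤ toℕ q × T p j ≡ true
    threeEdgeConnected : ∀ a b c d → StronglyConnected (removeEdge (removeEdge T a b) c d)

record BFSNormalForm {n} (G : Adj n) : Set where
  field
    size : ℕ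
    size≤n : size ≤ n
    matrix : Adj size
    normal : BFSNormal matrix
    iso : Isomorphic matrix G

bfsNormalForm : ∀ {n} (G : Adj n) → IsSimple G → Cubic G → ThreeEdgeConnected G → Fin n → BFSNormalForm G
bfsNormalForm {n} G simple cubic (_ , tec) s = record
  { size = size
  ; size≤n = injective-prefix⇒≤ size label (BFSPrefix.injective prefix)
  ; matrix = H
  ; normal = record
    { simple = IsSimple-reflect H≅G simple
    ; neighbours = λ i → Neighbours₃-reflect H≅G i (degree3⇒Neighbours₃ G (ψ i) (cubic (ψ i)))
    ; parent = parent
    ; parent-monotone = parent-monotone
    ; threeEdgeConnected = removeEdge²-StronglyConnected-transport (Isomorphic-sym H≅G) tec }
  ; iso = H≅G }
  where
  connected : Connected G
  connected x y = reach-mono (λ u v e → ∧-elimˡ (∧-elimˡ e)) (tec s s s s x y)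
  open BreadthFirst G simple connected s
  open BFSLabelling breadth-first-labelling
  ψ : Fin size → Fin n
  ψ i = label (toℕ i)
  index : Fin n → Fin size
  index y = fromℕ< (proj₁ (proj₂ (surjective y)))
  ψ-index : ∀ y → ψ (index y) ≡ y
  ψ-index y rewrite toℕ-fromℕ< (proj₁ (proj₂ (surjective y))) = proj₂ (proj₂ (surjective y))
  index-ψ : ∀ x → index (ψ x) ≡ x
  index-ψ x = toℕ-injective (trans (toℕ-fromℕ< (proj₁ (proj₂ (surjective (ψ x)))))
    (BFSPrefix.injective prefix _ (toℕ x) (proj₁ (proj₂ (surjective (ψ x)))) (toℕ<n x) (proj₂ (proj₂ (surjective (ψ x))))))
  H : Adj size
  H i j = G (ψ i) (ψ j)
  H≅G : Isomorphic H G
  H≅G = mkIsomorphic {H = G} ψ index index-ψ ψ-index (λ u v → refl)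
  asFin : ∀ p → p < size → Σ (Fin size) λ p′ → toℕ p′ ≡ p
  asFin p p<k = fromℕ< p<k , toℕ-fromℕ< p<k
  parent : ∀ j → 0 < toℕ j → ∃ λ p → toℕ p < toℕ j × H p j ≡ true
  parent j 0<j with BFSPrefix.parent prefix (toℕ j) 0<j (toℕ<n j)
  ... | p , p<j , e with asFin p (<-trans p<j (toℕ<n j))
  ...   | p′ , refl = p′ , p<j , e
  parent-monotone : ∀ j j′ q → 0 < toℕ j → toℕ j < toℕ j′ → H q j′ ≡ true → ∃ λ p → toℕ p ≤ toℕ q × H p j ≡ true
  parent-monotone j j′ q 0<j j<j′ e
    with BFSPrefix.parent-monotone prefix (toℕ j) (toℕ j′) (toℕ q) 0<j j<j′ (toℕ<n j′) (toℕ<n q) e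
  ... | p , p≤q , e′ with asFin p (≤-<-trans p≤q (toℕ<n q))
  ...   | p′ , refl = p′ , p≤q , e′

-- A finite case analysis over the values of a Total object at a list of Positions,
-- in which a branch is closed either because its partial assignment is refuted
-- or because the next certificate settles the Goal there.
record CaseAnalysis : Set₁ where
  field
    Position Partial Total Certificate : Set
    Admissible Goal : Total → Set
    value : Total → Position → Bool
    Agrees : Total → Partial → Set
    assign : Partial → Position → Bool → Partial
    assign-agrees : ∀ t M p → Admissible t → Agrees t M → Agrees t (assign M p (value t p))
    refuted : Position → Partial → Bool
    refuted-sound : ∀ t M p → refuted p M ≡ true → Agrees t M → Admissible t → ⊥
    settles : Partial → Certificate → Bool
    settles-sound : ∀ t M c → settles M c ≡ true → Agrees t M → Admissible t → Goal t

module CaseAnalysisCheck (P : CaseAnalysis) where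
  open CaseAnalysis P

  mutual
    check : List Position → Partial → List Certificate → Maybe (List Certificate)
    check [] M [] = nothing
    check [] M (c ∷ cs) = if settles M c then just cs else nothing
    check (p ∷ ps) M cs = branch p ps M false cs >>= branch p ps M true

    branch : Position → List Position → Partial → Bool → List Certificate → Maybe (List Certificate)
    branch p ps M b cs = unlessRefuted (refuted p (assign M p b)) ps (assign M p b) cs

    unlessRefuted : Bool → List Position → Partial → List Certificate → Maybe (List Certificate)
    unlessRefuted true ps M cs = just cs
    unlessRefuted false ps M cs = check ps M cs

  >>=-just : ∀ {A B : Set} (m : Maybe A) (f : A → Maybe B) {y} → (m >>= f) ≡ just y →
             Σ A (λ x → m ≡ just x × f x ≡ just y)
  >>=-just (just x) f e = x , refl , e

  mutual
    check-sound : ∀ ps M cs cs′ t → check ps M cs ≡ just cs′ → Agrees t M → Admissible t → Goal t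
    check-sound [] M (c ∷ cs) cs′ t e ag adm with settles M c in settled
    ... | true = settles-sound t M c settled ag adm
    check-sound [] M (c ∷ cs) cs′ t () ag adm | false
    check-sound (p ∷ ps) M cs cs′ t e ag adm with >>=-just (branch p ps M false cs) (branch p ps M true) e
    ... | cs₁ , e₁ , e₂ with value t p in v
    ...   | false = branch-sound p ps M false cs cs₁ t e₁ (subst (λ b → Agrees t (assign M p b)) v (assign-agrees t M p adm ag)) adm
    ...   | true = branch-sound p ps M true cs₁ cs′ t e₂ (subst (λ b → Agrees t (assign M p b)) v (assign-agrees t M p adm ag)) adm

    branch-sound : ∀ p ps M b cs cs′ t → branch p ps M b cs ≡ just cs′ → Agrees t (assign M p b) → Admissible t → Goal t
    branch-sound p ps M b cs cs′ t e ag adm with refuted p (assign M p b) in r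
    ... | true = ⊥-elim (refuted-sound t (assign M p b) p r ag adm)
    ... | false = check-sound ps (assign M p b) cs cs′ t e ag adm

-- Breadth-first search from x along R, keeping a path to every vertex found.
-- Only the candidate successors listed for each vertex are tried.
module ReachSearch {k : ℕ} (R : Adj k) (candidates : Vec (List (Fin k)) k) (x : Fin k) where
  Found : Set
  Found = Σ (Fin k) (Reach R x)

  mutual
    expand : (z : Fin k) → Reach R x z → List (Fin k) → Vec Bool k → List Found × Vec Bool k
    expand z pz [] seen = [] , seen
    expand z pz (w ∷ ws) seen = expand-one z pz w ws seen (R z w) refl (lookup seen w)

    expand-one : (z : Fin k) → Reach R x z → (w : Fin k) → List (Fin k) → Vec Bool k →
                 (b : Bool) → R z w ≡ b → Bool → List Found × Vec Bool k
    expand-one z pz w ws seen true e false = push (w , reach-snoc pz e) (expand z pz ws (seen [ w ]≔ true))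
    expand-one z pz w ws seen _ _ _ = expand z pz ws seen

    push : Found → List Found × Vec Bool k → List Found × Vec Bool k
    push f (fs , seen) = (f ∷ fs) , seen

  mutual
    search : ℕ → List Found → List Found → Vec Bool k → List Found
    search zero queue found seen = found
    search (suc fuel) [] found seen = found
    search (suc fuel) ((z , pz) ∷ queue) found seen = enqueue fuel queue found (expand z pz (lookup candidates z) seen)

    enqueue : ℕ → List Found → List Found → List Found × Vec Bool k → List Found
    enqueue fuel queue found (new , seen) = search fuel (queue ++ new) (new ++ found) seen

  closure : List Found
  closure = search (suc k) ((x , here) ∷ []) ((x , here) ∷ []) (replicate k false [ x ]≔ true)

  findPath : List Found → (y : Fin k) → Maybe (Reach R x y)
  findPath [] y = nothing
  findPath ((z , p) ∷ fs) y with z ≟ y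
  ... | yes refl = just p
  ... | no _ = findPath fs y

  found : List Found → Fin k → Bool
  found [] y = false
  found ((z , _) ∷ fs) y = z ≟ᵇ y ∨ found fs y

-- Classification of breadth-first normal matrices

-- A leaf is settled by two orientations (edge directions as bit masks, see
-- directionBit), by labels identifying the graph with the Petersen graph, or by
-- two edges and a vertex y that their removal separates from vertex 0.
data Certificate : Set where
  orientations : ℕ → ℕ → Certificate
  petersenLabels : List ℕ → Certificate
  twoEdgeCut : ℕ → ℕ → ℕ → ℕ → ℕ → Certificate

toFin? : ∀ k → ℕ → Maybe (Fin k)
toFin? zero x = nothing
toFin? (suc k) zero = just Fin.zero
toFin? (suc k) (suc x) with toFin? k x
... | just i = just (Fin.suc i)
... | nothing = nothing

firstVertex : ∀ k → Maybe (Fin k)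
firstVertex zero = nothing
firstVertex (suc k) = just Fin.zero

firstVertex-nothing : ∀ k → firstVertex k ≡ nothing → ¬ Fin k
firstVertex-nothing (suc k) () x

nthOr0 : List ℕ → ℕ → ℕ
nthOr0 [] _ = 0
nthOr0 (x ∷ xs) zero = x
nthOr0 (x ∷ xs) (suc i) = nthOr0 xs i

toFin10 : ℕ → Fin 10
toFin10 x with toFin? 10 x
... | just i = i
... | nothing = Fin.zero

halve : ℕ → ℕ → ℕ
halve zero m = m
halve (suc t) m = halve t (m / 2)

bit : ℕ → ℕ → Bool
bit m t = (halve t m % 2) ≡ᵇ 1

module Classification (k : ℕ) where

  Partial : Set
  Partial = Vec (Vec (Maybe Bool) k) k

  entry : Partial → Fin k → Fin k → Maybe Bool
  entry M i j = lookup (lookup M i) j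

  setEntry : Partial → Fin k → Fin k → Bool → Partial
  setEntry M i j b = updateAt M i (λ row → row [ j ]≔ just b)

  setEdge : Partial → Fin k × Fin k → Bool → Partial
  setEdge M (i , j) b = setEntry (setEntry M i j b) j i b

  entry-setEntry : ∀ M i j b x y c → entry (setEntry M i j b) x y ≡ just c →
                   (x ≡ i × y ≡ j × b ≡ c) ⊎ entry M x y ≡ just c
  entry-setEntry M i j b x y c e with x ≟ i
  ... | no x≢i rewrite lookup∘updateAt′ x i {f = λ row → row [ j ]≔ just b} x≢i M = inj₂ e
  ... | yes refl rewrite lookup∘updateAt x {f = λ row → row [ j ]≔ just b} M with y ≟ j
  ...   | yes refl rewrite lookup∘update y (lookup M x) (just b) with e
  ...     | refl = inj₁ (refl , refl , refl)
  entry-setEntry M i j b x y c e | yes refl | no y≢j rewrite lookup∘update′ y≢j (lookup M x) (just b) = inj₂ e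

  Agrees : Adj k → Partial → Set
  Agrees T M = ∀ i j b → entry M i j ≡ just b → T i j ≡ b

  setEntry-agrees : ∀ T M i j → Agrees T M → Agrees T (setEntry M i j (T i j))
  setEntry-agrees T M i j ag x y c e with entry-setEntry M i j (T i j) x y c e
  ... | inj₁ (refl , refl , eq) = eq
  ... | inj₂ e′ = ag x y c e′

  setEdge-agrees : ∀ T M p → BFSNormal T → Agrees T M → Agrees T (setEdge M p (T (proj₁ p) (proj₂ p)))
  setEdge-agrees T M (i , j) normal ag =
    subst (λ b → Agrees T (setEntry (setEntry M i j (T i j)) j i b)) (IsSimple.symm (BFSNormal.simple normal) j i)
      (setEntry-agrees T (setEntry M i j (T i j)) j i (setEntry-agrees T M i j ag))

  loopless : Partial
  loopless = tabulate λ i → tabulate λ j → if i ≟ᵇ j then just false else nothing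

  loopless-agrees : ∀ T → BFSNormal T → Agrees T loopless
  loopless-agrees T normal i j b e
    rewrite lookup∘tabulate (λ i → tabulate λ j → if i ≟ᵇ j then just false else nothing) i
          | lookup∘tabulate (λ j → if i ≟ᵇ j then just false else nothing) j with i ≟ j
  ... | yes refl with e
  ...   | refl = IsSimple.irrefl (BFSNormal.simple normal) i
  loopless-agrees T normal i j b () | no _

  knownNeighbours : Partial → Fin k → List (Fin k)
  knownNeighbours M r = filterᵇ (λ j → is-just-true (entry M r j)) (allFin k)

  atLeast4 : List (Fin k) → Bool
  atLeast4 (_ ∷ _ ∷ _ ∷ _ ∷ _) = true
  atLeast4 _ = false

  atMost2 : List (Fin k) → Bool
  atMost2 [] = true
  atMost2 (_ ∷ []) = true
  atMost2 (_ ∷ _ ∷ []) = true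
  atMost2 _ = false

  rowKnown : Partial → Fin k → Bool
  rowKnown M r = allᶠ (λ j → is-just (entry M r j))

  degreeViolated : Partial → Fin k → Bool
  degreeViolated M r = atLeast4 (knownNeighbours M r) ∨ (rowKnown M r ∧ atMost2 (knownNeighbours M r))

  orphan : Partial → Fin k → Bool
  orphan M j = (0 <ᵇ toℕ j) ∧ allᶠ (λ p → p <ᶠ j ⇒ᵇ is-just-false (entry M p j))

  parentOrderViolated : Partial → Fin k → Fin k → Bool
  parentOrderViolated M q j′ = is-just-true (entry M q j′) ∧
    anyᶠ (λ j → (0 <ᵇ toℕ j) ∧ (j <ᶠ j′ ∧ allᶠ (λ p → p ≤ᶠ q ⇒ᵇ is-just-false (entry M p j))))

  refuted : Fin k × Fin k → Partial → Bool
  refuted (i , j) M = degreeViolated M i ∨ (degreeViolated M j ∨ (orphan M j ∨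
                      (parentOrderViolated M i j ∨ parentOrderViolated M j i)))

  module Refutation (T : Adj k) (M : Partial) (ag : Agrees T M) (normal : BFSNormal T) where
    open BFSNormal normal

    knownNeighbours-unique : ∀ r → Unique (knownNeighbours M r)
    knownNeighbours-unique r = filter⁺ (λ x → T? (is-just-true (entry M r x))) (allFin⁺ k)

    knownNeighbours-sound : ∀ r {x} → x ∈ knownNeighbours M r → T r x ≡ true
    knownNeighbours-sound r m = ag r _ true (is-just-true-sound (T⇒≡true
      (proj₂ (∈-filter⁻ (λ x → T? (is-just-true (entry M r x))) {xs = allFin k} m))))

    knownNeighbours-complete : ∀ r x → entry M r x ≡ just true → x ∈ knownNeighbours M r
    knownNeighbours-complete r x e =
      ∈-filter⁺ (λ x → T? (is-just-true (entry M r x))) (∈-allFin x) (≡true⇒T (cong is-just-true e))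

    atLeast4-length : ∀ L → atLeast4 L ≡ true → 4 ≤ length L
    atLeast4-length (_ ∷ _ ∷ _ ∷ _ ∷ _) _ = s≤s (s≤s (s≤s (s≤s z≤n)))

    atMost2-three-members : ∀ L {a b c} → atMost2 L ≡ true → a ∈ L → b ∈ L → c ∈ L → a ≢ b → a ≢ c → b ≢ c → ⊥
    atMost2-three-members (x ∷ []) _ (here refl) (here refl) _ a≢b _ _ = a≢b refl
    atMost2-three-members (x ∷ y ∷ []) _ (here refl) (here refl) _ a≢b _ _ = a≢b refl
    atMost2-three-members (x ∷ y ∷ []) _ (there (here refl)) (there (here refl)) _ a≢b _ _ = a≢b refl
    atMost2-three-members (x ∷ y ∷ []) _ (here refl) (there (here refl)) (here refl) _ a≢c _ = a≢c refl
    atMost2-three-members (x ∷ y ∷ []) _ (here refl) (there (here refl)) (there (here refl)) _ _ b≢c = b≢c refl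
    atMost2-three-members (x ∷ y ∷ []) _ (there (here refl)) (here refl) (here refl) _ _ b≢c = b≢c refl
    atMost2-three-members (x ∷ y ∷ []) _ (there (here refl)) (here refl) (there (here refl)) _ a≢c _ = a≢c refl

    degreeViolated-sound : ∀ r → degreeViolated M r ≡ true → ⊥
    degreeViolated-sound r e with ∨-elim {atLeast4 (knownNeighbours M r)} e
    ... | inj₁ many = ℕₚ.<-irrefl refl (ℕₚ.≤-trans (atLeast4-length _ many)
          (Neighbours₃-length≤3 (neighbours r) (knownNeighbours M r) (knownNeighbours-unique r) (knownNeighbours-sound r)))
    ... | inj₂ few with neighbours r
    ...   | neighbours₃ a b c a≢b a≢c b≢c ea eb ec _ =
            atMost2-three-members (knownNeighbours M r) (∧-elimʳ {rowKnown M r} few) (known a ea) (known b eb) (known c ec) a≢b a≢c b≢c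
      where
      known : ∀ x → T r x ≡ true → x ∈ knownNeighbours M r
      known x e with is-just-sound (allᶠ-sound (λ j → is-just (entry M r j)) (∧-elimˡ few) x)
      ... | b , eb with trans (sym (ag r x b eb)) e
      ...   | refl = knownNeighbours-complete r x eb

    orphan-sound : ∀ j → orphan M j ≡ true → ⊥
    orphan-sound j e with parent j (ℕₚ.<ᵇ⇒< 0 (toℕ j) (≡true⇒T (∧-elimˡ e)))
    ... | p , p<j , tp = false≢true (trans (sym (ag p j false (is-just-false-sound
          (⇒ᵇ-elim (allᶠ-sound _ (∧-elimʳ {0 <ᵇ toℕ j} e) p) (<ᶠ-complete p<j))))) tp)

    parentOrderViolated-sound : ∀ q j′ → parentOrderViolated M q j′ ≡ true → ⊥
    parentOrderViolated-sound q j′ e with anyᶠ-sound _ (∧-elimʳ {is-just-true (entry M q j′)} e)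
    ... | j , ej with parent-monotone j j′ q (ℕₚ.<ᵇ⇒< 0 (toℕ j) (≡true⇒T (∧-elimˡ ej)))
                        (<ᶠ-sound (∧-elimˡ (∧-elimʳ {0 <ᵇ toℕ j} ej)))
                        (ag q j′ true (is-just-true-sound (∧-elimˡ e)))
    ...   | p , p≤q , tp = false≢true (trans (sym (ag p j false (is-just-false-sound
            (⇒ᵇ-elim (allᶠ-sound _ (∧-elimʳ {j <ᶠ j′} (∧-elimʳ {0 <ᵇ toℕ j} ej)) p) (≤ᶠ-complete p≤q))))) tp)

    refuted-sound : ∀ p → refuted p M ≡ true → ⊥
    refuted-sound (i , j) e with ∨-elim {degreeViolated M i} e
    ... | inj₁ e₁ = degreeViolated-sound i e₁
    ... | inj₂ e₂ with ∨-elim {degreeViolated M j} e₂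
    ...   | inj₁ e₃ = degreeViolated-sound j e₃
    ...   | inj₂ e₄ with ∨-elim {orphan M j} e₄
    ...     | inj₁ e₅ = orphan-sound j e₅
    ...     | inj₂ e₆ with ∨-elim {parentOrderViolated M i j} e₆
    ...       | inj₁ e₇ = parentOrderViolated-sound i j e₇
    ...       | inj₂ e₈ = parentOrderViolated-sound j i e₈

  completion : Partial → Adj k
  completion M i j = is-just-true (entry M i j)

  known : Partial → Bool
  known M = allᶠ (λ i → rowKnown M i)

  is-just-true-just : ∀ b → b ≡ is-just-true (just b)
  is-just-true-just true = refl
  is-just-true-just false = refl

  known-agrees : ∀ T M → Agrees T M → known M ≡ true → ∀ i j → T i j ≡ completion M i j
  known-agrees T M ag kn i j with is-just-sound (allᶠ-sound _ (allᶠ-sound _ kn i) j)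
  ... | b , e rewrite e = trans (ag i j b e) (is-just-true-just b)

  AdjacencyLists : Set
  AdjacencyLists = Vec (List (Fin k)) k

  adjacencyLists : Partial → AdjacencyLists
  adjacencyLists M = tabulate (λ i → filterᵇ (completion M i) (allFin k))

  Directions : Set
  Directions = Vec (Vec Bool k) k

  -- Bit u * k + v of m gives the direction of the edge {u , v}, u < v.
  directionBit : ℕ → Fin k → Fin k → Bool
  directionBit m u v = if u <ᶠ v then bit m (toℕ u * k + toℕ v) else not (bit m (toℕ v * k + toℕ u))

  decodeDirections : ℕ → Directions
  decodeDirections m = tabulate λ u → tabulate λ v → directionBit m u v

  direction : Directions → Fin k → Fin k → Bool
  direction D u v = lookup (lookup D u) v

  orientedArcs : Partial → Directions → Adj k
  orientedArcs M D u v = completion M u v ∧ direction D u v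

  isOrientation : Partial → Directions → Bool
  isOrientation M D = allᶠ λ u → allᶠ λ v →
    completion M u v ⇒ᵇ (completion M v u ∧ direction D u v == not (direction D v u))

  reachableᵇ : AdjacencyLists → Adj k → Fin k → Fin k → Bool
  reachableᵇ C R a b = is-just (ReachSearch.findPath R C a (ReachSearch.closure R C a) b)

  reachesAllAndBackᵇ : (C : AdjacencyLists) (R : Adj k) (h : Fin k) →
    List (ReachSearch.Found R C h) → List (ReachSearch.Found (flip R) C h) → Bool
  reachesAllAndBackᵇ C R h out back = allᶠ (λ y →
    is-just (ReachSearch.findPath R C h out y) ∧ is-just (ReachSearch.findPath (flip R) C h back y))

  stronglyConnectedᵇ : AdjacencyLists → Adj k → Fin k → Bool
  stronglyConnectedᵇ C R h =
    reachesAllAndBackᵇ C R h (ReachSearch.closure R C h) (ReachSearch.closure (flip R) C h)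

  deletableᵇ : AdjacencyLists → Partial → Directions → Fin k → Fin k → Bool
  deletableᵇ C M D u v = if direction D u v then reachableᵇ C (removeEdge (orientedArcs M D) u v) u v
                                            else reachableᵇ C (removeEdge (orientedArcs M D) u v) v u

  coveredᵇ : AdjacencyLists → Partial → Directions → Directions → Bool → Bool → Bool
  coveredᵇ C M D₁ D₂ sc₁ sc₂ = allᶠ λ u → allᶠ λ v →
    (completion M u v ∧ u <ᶠ v) ⇒ᵇ ((sc₁ ∧ deletableᵇ C M D₁ u v) ∨ (sc₂ ∧ deletableᵇ C M D₂ u v))

  coverCheck : AdjacencyLists → Partial → Directions → Directions → Maybe (Fin k) → Bool
  coverCheck C M D₁ D₂ nothing = true
  coverCheck C M D₁ D₂ (just h) = isOrientation M D₁ ∧ (isOrientation M D₂ ∧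
    coveredᵇ C M D₁ D₂ (stronglyConnectedᵇ C (orientedArcs M D₁) h) (stronglyConnectedᵇ C (orientedArcs M D₂) h))

  petersenCheck : Partial → (Fin k → Fin 10) → Bool
  petersenCheck M π = allᶠ (λ i → allᶠ (λ j → π i ≟ᵇ π j ⇒ᵇ i ≟ᵇ j)) ∧
    (allᶠ (λ (a : Fin 10) → anyᶠ (λ i → π i ≟ᵇ a)) ∧
     allᶠ (λ i → allᶠ (λ j → completion M i j == petersen (π i) (π j))))

  -- Removing the two edges separates h from y: the vertices found from h miss y and
  -- are closed under R.
  separatesᵇ : (R : Adj k) (C : AdjacencyLists) (h y : Fin k) → List (ReachSearch.Found R C h) → Bool
  separatesᵇ R C h y L = ReachSearch.found R C h L h ∧ (not (ReachSearch.found R C h L y) ∧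
    allᶠ (λ u → ReachSearch.found R C h L u ⇒ᵇ allᶠ (λ w → R u w ⇒ᵇ ReachSearch.found R C h L w)))

  removeTwo : Partial → Fin k → Fin k → Fin k → Fin k → Adj k
  removeTwo M a b c d = removeEdge (removeEdge (completion M) a b) c d

  cutCheck : AdjacencyLists → Partial → Maybe (Fin k) → Maybe (Fin k) → Maybe (Fin k) → Maybe (Fin k) →
             Maybe (Fin k) → Maybe (Fin k) → Bool
  cutCheck C M (just a) (just b) (just c) (just d) (just y) (just h) =
    separatesᵇ (removeTwo M a b c d) C h y (ReachSearch.closure (removeTwo M a b c d) C h)
  cutCheck C M _ _ _ _ _ _ = false

  certificateCheck : AdjacencyLists → Partial → Certificate → Bool
  certificateCheck C M (orientations m₁ m₂) = coverCheck C M (decodeDirections m₁) (decodeDirections m₂) (firstVertex k)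
  certificateCheck C M (petersenLabels πs) = petersenCheck M (λ i → toFin10 (nthOr0 πs (toℕ i)))
  certificateCheck C M (twoEdgeCut a b c d y) =
    cutCheck C M (toFin? k a) (toFin? k b) (toFin? k c) (toFin? k d) (toFin? k y) (firstVertex k)

  settles : Partial → Certificate → Bool
  settles M c = known M ∧ certificateCheck (adjacencyLists M) M c

  findPath-sound : ∀ (R : Adj k) C h (L : List (ReachSearch.Found R C h)) y →
                   is-just (ReachSearch.findPath R C h L y) ≡ true → Reach R h y
  findPath-sound R C h L y e = proj₁ (is-just-sound e)

  stronglyConnectedᵇ-sound : ∀ C R h → stronglyConnectedᵇ C R h ≡ true → StronglyConnected R
  stronglyConnectedᵇ-sound C R h e x y =
    reach-trans (reach-flip (findPath-sound (flip R) C h back x (∧-elimʳ {is-just (ReachSearch.findPath R C h out x)} (allᶠ-sound _ e x))))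
                (findPath-sound R C h out y (∧-elimˡ (allᶠ-sound _ e y)))
    where
    out : List (ReachSearch.Found R C h)
    out = ReachSearch.closure R C h
    back : List (ReachSearch.Found (flip R) C h)
    back = ReachSearch.closure (flip R) C h

  found-closed : ∀ (R : Adj k) C h (L : List (ReachSearch.Found R C h)) →
    (∀ u → (ReachSearch.found R C h L u ⇒ᵇ allᶠ (λ w → R u w ⇒ᵇ ReachSearch.found R C h L w)) ≡ true) →
    ∀ {x y} → ReachSearch.found R C h L x ≡ true → Reach R x y → ReachSearch.found R C h L y ≡ true
  found-closed R C h L closed fx here = fx
  found-closed R C h L closed {x} fx (step {v = z} e p) =
    found-closed R C h L closed (⇒ᵇ-elim (allᶠ-sound _ (⇒ᵇ-elim (closed x) fx) z) e) p

  module Settled (T : Adj k) (M : Partial) (ag : Agrees T M) (normal : BFSNormal T) (kn : known M ≡ true) where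
    open BFSNormal normal
    open IsSimple simple

    T≡completion : ∀ u v → T u v ≡ completion M u v
    T≡completion = known-agrees T M ag kn

    orientation : (D : Directions) → isOrientation M D ≡ true → Orientation T
    orientation D ok = record
      { arc = orientedArcs M D
      ; onEdges = λ u v e → trans (T≡completion u v) (∧-elimˡ e)
      ; exactlyOne = exactlyOne′ }
      where
      exactlyOne′ : ∀ u v → T u v ≡ true → orientedArcs M D u v ≡ not (orientedArcs M D v u)
      exactlyOne′ u v tuv with trans (sym (T≡completion u v)) tuv
      ... | cuv with ⇒ᵇ-elim (allᶠ-sound _ (allᶠ-sound _ ok u) v) cuv
      ...   | r = trans (cong (_∧ direction D u v) cuv) (trans (==-sound (∧-elimʳ {completion M v u} r))
                     (cong not (sym (cong (_∧ direction D v u) (∧-elimˡ r)))))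

    module _ (C : AdjacencyLists) (D : Directions) (h : Fin k)
             (sc : stronglyConnectedᵇ C (orientedArcs M D) h ≡ true) (u v : Fin k) where
      O-uv : Adj k
      O-uv = removeEdge (orientedArcs M D) u v

      deletable-via : ∀ a b → orientedArcs M D b a ≡ false → (a ≡ u × b ≡ v) ⊎ (a ≡ v × b ≡ u) →
                      reachableᵇ C O-uv a b ≡ true → StronglyConnected O-uv
      deletable-via a b ba ab reach x y =
        removeEdge-reroute (orientedArcs M D) u v a b ba ab (findPath-sound O-uv C a (ReachSearch.closure O-uv C a) b reach)
          (stronglyConnectedᵇ-sound C _ h sc x y)

      deletableᵇ-sound : (ok : isOrientation M D ≡ true) → completion M u v ≡ true →
                         deletableᵇ C M D u v ≡ true → Deletable (orientation D ok) u v
      deletableᵇ-sound ok cuv del with ⇒ᵇ-elim (allᶠ-sound _ (allᶠ-sound _ ok u) v) cuv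
      ... | r with direction D u v in duv
      ...   | true = deletable-via u v (trans (cong (completion M v u ∧_) dvu) (∧-zeroʳ _)) (inj₁ (refl , refl)) del
        where
        dvu : direction D v u ≡ false
        dvu = not-true (sym (==-sound (∧-elimʳ {completion M v u} r)))
      ...   | false = deletable-via v u (trans (cong (completion M u v ∧_) duv) (∧-zeroʳ _)) (inj₂ (refl , refl)) del

    module _ (C : AdjacencyLists) (D₁ D₂ : Directions) (h : Fin k)
             (ok₁ : isOrientation M D₁ ≡ true) (ok₂ : isOrientation M D₂ ≡ true)
             (covered : coveredᵇ C M D₁ D₂ (stronglyConnectedᵇ C (orientedArcs M D₁) h)
                                           (stronglyConnectedᵇ C (orientedArcs M D₂) h) ≡ true) where
      pair : Fin 2 → Orientation T
      pair 0F = orientation D₁ ok₁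
      pair 1F = orientation D₂ ok₂

      covered-< : ∀ u v → completion M u v ≡ true → toℕ u < toℕ v → ∃ λ (i : Fin 2) → Deletable (pair i) u v
      covered-< u v cuv u<v with ∨-elim (⇒ᵇ-elim (allᶠ-sound _ (allᶠ-sound _ covered u) v) (∧-intro cuv (<ᶠ-complete u<v)))
      ... | inj₁ e = 0F , deletableᵇ-sound C D₁ h (∧-elimˡ e) u v ok₁ cuv (∧-elimʳ {stronglyConnectedᵇ C (orientedArcs M D₁) h} e)
      ... | inj₂ e = 1F , deletableᵇ-sound C D₂ h (∧-elimˡ e) u v ok₂ cuv (∧-elimʳ {stronglyConnectedᵇ C (orientedArcs M D₂) h} e)

      pair-covers : Covers T 2
      pair-covers = pair , covered′
        where
        covered′ : ∀ u v → T u v ≡ true → ∃ λ (i : Fin 2) → Deletable (pair i) u v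
        covered′ u v tuv with <-cmp (toℕ u) (toℕ v)
        ... | tri< u<v _ _ = covered-< u v (trans (sym (T≡completion u v)) tuv) u<v
        ... | tri≈ _ u≡v _ = ⊥-elim (false≢true (trans (sym (irrefl u)) (subst (λ z → T u z ≡ true) (sym (toℕ-injective u≡v)) tuv)))
        ... | tri> _ _ v<u with covered-< v u (trans (sym (T≡completion v u)) (trans (symm v u) tuv)) v<u
        ...   | i , d = i , λ x y → reach-mono (removeEdge-sym (arc (pair i)) u v) (d x y)

    coverCheck-sound : ∀ C D₁ D₂ h? → coverCheck C M D₁ D₂ h? ≡ true → firstVertex k ≡ h? → Covers T 2
    coverCheck-sound C D₁ D₂ (just h) e _ = pair-covers C D₁ D₂ h (∧-elimˡ e) (∧-elimˡ (∧-elimʳ {isOrientation M D₁} e))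
                                              (∧-elimʳ {isOrientation M D₂} (∧-elimʳ {isOrientation M D₁} e))
    coverCheck-sound C D₁ D₂ nothing e none = (λ _ → noArcs) , λ u → ⊥-elim (firstVertex-nothing k none u)
      where
      noArcs : Orientation T
      noArcs = record { arc = λ _ _ → false ; onEdges = λ u → ⊥-elim (firstVertex-nothing k none u)
                      ; exactlyOne = λ u → ⊥-elim (firstVertex-nothing k none u) }

    petersenCheck-sound : ∀ π → petersenCheck M π ≡ true → Isomorphic T petersen
    petersenCheck-sound π e = mkIsomorphic {H = petersen} π σ σπ πσ adjacent
      where
      injectiveᵇ surjectiveᵇ adjacentᵇ : Bool
      injectiveᵇ = allᶠ (λ i → allᶠ (λ j → π i ≟ᵇ π j ⇒ᵇ i ≟ᵇ j))
      surjectiveᵇ = allᶠ (λ (a : Fin 10) → anyᶠ (λ i → π i ≟ᵇ a))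
      adjacentᵇ = allᶠ (λ i → allᶠ (λ j → completion M i j == petersen (π i) (π j)))
      preimage : ∀ a → ∃ λ i → π i ≟ᵇ a ≡ true
      preimage a = anyᶠ-sound _ (allᶠ-sound (λ (a : Fin 10) → anyᶠ (λ i → π i ≟ᵇ a)) (∧-elimˡ (∧-elimʳ {injectiveᵇ} e)) a)
      σ : Fin 10 → Fin k
      σ a = proj₁ (preimage a)
      πσ : ∀ a → π (σ a) ≡ a
      πσ a = ≟ᵇ-sound (proj₂ (preimage a))
      π-injective : ∀ i j → π i ≡ π j → i ≡ j
      π-injective i j eq = ≟ᵇ-sound (⇒ᵇ-elim (allᶠ-sound _ (allᶠ-sound (λ i → allᶠ (λ j → π i ≟ᵇ π j ⇒ᵇ i ≟ᵇ j)) (∧-elimˡ e) i) j)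
                                      (subst (λ z → π i ≟ᵇ z ≡ true) eq (≟ᵇ-refl (π i))))
      σπ : ∀ x → σ (π x) ≡ x
      σπ x = π-injective (σ (π x)) x (πσ (π x))
      adjacent : ∀ a b → T a b ≡ petersen (π a) (π b)
      adjacent a b = trans (T≡completion a b)
        (==-sound (allᶠ-sound _ (allᶠ-sound _ (∧-elimʳ {surjectiveᵇ} (∧-elimʳ {injectiveᵇ} e)) a) b))

    cutCheck-sound : ∀ C a? b? c? d? y? h? → cutCheck C M a? b? c? d? y? h? ≡ true → ⊥
    cutCheck-sound C (just a) (just b) (just c) (just d) (just y) (just h) e =
      false≢true (trans (sym (not-true (∧-elimˡ (∧-elimʳ {ReachSearch.found R C h L h} e))))
        (found-closed R C h L (allᶠ-sound _ (∧-elimʳ {not (ReachSearch.found R C h L y)} (∧-elimʳ {ReachSearch.found R C h L h} e)))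
          (∧-elimˡ e) (reach-mono same (threeEdgeConnected a b c d h y))))
      where
      R : Adj k
      R = removeTwo M a b c d
      L : List (ReachSearch.Found R C h)
      L = ReachSearch.closure R C h
      same : ∀ x z → removeEdge (removeEdge T a b) c d x z ≡ true → R x z ≡ true
      same x z e rewrite T≡completion x z = e
    cutCheck-sound C nothing _ _ _ _ _ ()
    cutCheck-sound C (just _) nothing _ _ _ _ ()
    cutCheck-sound C (just _) (just _) nothing _ _ _ ()
    cutCheck-sound C (just _) (just _) (just _) nothing _ _ ()
    cutCheck-sound C (just _) (just _) (just _) (just _) nothing _ ()
    cutCheck-sound C (just _) (just _) (just _) (just _) (just _) nothing ()

  settles-sound : ∀ T M c → settles M c ≡ true → Agrees T M → BFSNormal T → Isomorphic T petersen ⊎ Covers T 2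
  settles-sound T M (orientations m₁ m₂) e ag normal =
    inj₂ (Settled.coverCheck-sound T M ag normal (∧-elimˡ e) (adjacencyLists M) (decodeDirections m₁) (decodeDirections m₂)
           (firstVertex k) (∧-elimʳ {known M} e) refl)
  settles-sound T M (petersenLabels πs) e ag normal =
    inj₁ (Settled.petersenCheck-sound T M ag normal (∧-elimˡ e) _ (∧-elimʳ {known M} e))
  settles-sound T M (twoEdgeCut a b c d y) e ag normal =
    ⊥-elim (Settled.cutCheck-sound T M ag normal (∧-elimˡ e) (adjacencyLists M)
             (toFin? k a) (toFin? k b) (toFin? k c) (toFin? k d) (toFin? k y) (firstVertex k) (∧-elimʳ {known M} e))

  analysis : CaseAnalysis
  analysis = record
    { Position = Fin k × Fin k
    ; Partial = Partial
    ; Total = Adj k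
    ; Certificate = Certificate
    ; Admissible = BFSNormal
    ; Goal = λ T → Isomorphic T petersen ⊎ Covers T 2
    ; value = λ T p → T (proj₁ p) (proj₂ p)
    ; Agrees = Agrees
    ; assign = setEdge
    ; assign-agrees = setEdge-agrees
    ; refuted = refuted
    ; refuted-sound = λ T M p e ag normal → Refutation.refuted-sound T M ag normal p e
    ; settles = settles
    ; settles-sound = settles-sound }

  upperPairs : List (Fin k × Fin k)
  upperPairs = List.concatMap (λ i → List.map (i ,_) (filterᵇ (i <ᶠ_) (allFin k))) (allFin k)

  classify : (certs : List Certificate) → CaseAnalysisCheck.check analysis upperPairs loopless certs ≡ just [] →
             ∀ T → BFSNormal T → Isomorphic T petersen ⊎ Covers T 2
  classify certs e T normal = CaseAnalysisCheck.check-sound analysis upperPairs loopless certs [] T e (loopless-agrees T normal) normal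

-- The Petersen graph

-- Edge e of the Petersen graph joins tail e to head e, in the order of petersenEdges.
edgeTable : Vec (Fin 10 × Fin 10) 15
edgeTable = (0F , 1F) Vec.∷ (1F , 2F) Vec.∷ (2F , 3F) Vec.∷ (3F , 4F) Vec.∷ (4F , 0F) Vec.∷
            (0F , 5F) Vec.∷ (1F , 6F) Vec.∷ (2F , 7F) Vec.∷ (3F , 8F) Vec.∷ (4F , 9F) Vec.∷
            (5F , 7F) Vec.∷ (7F , 9F) Vec.∷ (9F , 6F) Vec.∷ (6F , 8F) Vec.∷ (8F , 5F) Vec.∷ Vec.[]

tail head : Fin 15 → Fin 10
tail e = proj₁ (lookup edgeTable e)
head e = proj₂ (lookup edgeTable e)

neighbourTable : Vec (Vec (Fin 10) 3) 10
neighbourTable =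
  (1F Vec.∷ 4F Vec.∷ 5F Vec.∷ Vec.[]) Vec.∷ (0F Vec.∷ 2F Vec.∷ 6F Vec.∷ Vec.[]) Vec.∷
  (1F Vec.∷ 3F Vec.∷ 7F Vec.∷ Vec.[]) Vec.∷ (2F Vec.∷ 4F Vec.∷ 8F Vec.∷ Vec.[]) Vec.∷
  (3F Vec.∷ 0F Vec.∷ 9F Vec.∷ Vec.[]) Vec.∷ (0F Vec.∷ 7F Vec.∷ 8F Vec.∷ Vec.[]) Vec.∷
  (1F Vec.∷ 9F Vec.∷ 8F Vec.∷ Vec.[]) Vec.∷ (2F Vec.∷ 5F Vec.∷ 9F Vec.∷ Vec.[]) Vec.∷
  (3F Vec.∷ 6F Vec.∷ 5F Vec.∷ Vec.[]) Vec.∷ (4F Vec.∷ 7F Vec.∷ 6F Vec.∷ Vec.[]) Vec.∷ Vec.[]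

nbr : Fin 10 → Fin 3 → Fin 10
nbr w i = lookup (lookup neighbourTable w) i

-- head e is neighbour number tailSlot e of tail e, and tail e is neighbour number
-- headSlot e of head e.
endSlotTable : Vec (Fin 3 × Fin 3) 15
endSlotTable = (0F , 0F) Vec.∷ (1F , 0F) Vec.∷ (1F , 0F) Vec.∷ (1F , 0F) Vec.∷ (1F , 1F) Vec.∷
               (2F , 0F) Vec.∷ (2F , 0F) Vec.∷ (2F , 0F) Vec.∷ (2F , 0F) Vec.∷ (2F , 0F) Vec.∷
               (1F , 1F) Vec.∷ (2F , 1F) Vec.∷ (2F , 1F) Vec.∷ (2F , 1F) Vec.∷ (2F , 2F) Vec.∷ Vec.[]

tailSlot headSlot : Fin 15 → Fin 3
tailSlot e = proj₁ (lookup endSlotTable e)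
headSlot e = proj₂ (lookup endSlotTable e)

-- The edges sharing an endpoint with e, e included.
incident : Fin 15 → List (Fin 15)
incident 0F = # 0 ∷ # 1 ∷ # 4 ∷ # 5 ∷ # 6 ∷ []
incident 1F = # 0 ∷ # 1 ∷ # 2 ∷ # 6 ∷ # 7 ∷ []
incident 2F = # 1 ∷ # 2 ∷ # 3 ∷ # 7 ∷ # 8 ∷ []
incident 3F = # 2 ∷ # 3 ∷ # 4 ∷ # 8 ∷ # 9 ∷ []
incident 4F = # 0 ∷ # 3 ∷ # 4 ∷ # 5 ∷ # 9 ∷ []
incident 5F = # 0 ∷ # 4 ∷ # 5 ∷ # 10 ∷ # 14 ∷ []
incident 6F = # 0 ∷ # 1 ∷ # 6 ∷ # 12 ∷ # 13 ∷ []
incident 7F = # 1 ∷ # 2 ∷ # 7 ∷ # 10 ∷ # 11 ∷ []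
incident 8F = # 2 ∷ # 3 ∷ # 8 ∷ # 13 ∷ # 14 ∷ []
incident 9F = # 3 ∷ # 4 ∷ # 9 ∷ # 11 ∷ # 12 ∷ []
incident (Fin.suc 9F) = # 5 ∷ # 7 ∷ # 10 ∷ # 11 ∷ # 14 ∷ []
incident (Fin.suc (Fin.suc 9F)) = # 7 ∷ # 9 ∷ # 10 ∷ # 11 ∷ # 12 ∷ []
incident (Fin.suc (Fin.suc (Fin.suc 9F))) = # 6 ∷ # 9 ∷ # 11 ∷ # 12 ∷ # 13 ∷ []
incident (Fin.suc (Fin.suc (Fin.suc (Fin.suc 9F)))) = # 6 ∷ # 8 ∷ # 12 ∷ # 13 ∷ # 14 ∷ []
incident (Fin.suc (Fin.suc (Fin.suc (Fin.suc (Fin.suc 9F))))) = # 5 ∷ # 8 ∷ # 10 ∷ # 13 ∷ # 14 ∷ []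

nbr-adjacent : ∀ w i → petersen w (nbr w i) ≡ true
nbr-adjacent w = allᶠ-sound _ (allᶠ-sound (λ w → allᶠ (λ i → petersen w (nbr w i))) refl w)

adjacent-nbr : ∀ w y → petersen w y ≡ true → ∃ λ i → y ≡ nbr w i
adjacent-nbr w y e =
  let (i , eq) = anyᶠ-sound (λ i → y ≟ᵇ nbr w i) (⇒ᵇ-elim (allᶠ-sound (λ y → petersen w y ⇒ᵇ anyᶠ (λ i → y ≟ᵇ nbr w i))
        (allᶠ-sound (λ w → allᶠ (λ y → petersen w y ⇒ᵇ anyᶠ (λ i → y ≟ᵇ nbr w i))) refl w) y) e)
  in i , ≟ᵇ-sound eq

endSlots-correct : ∀ e → nbr (tail e) (tailSlot e) ≟ᵇ head e ∧ nbr (head e) (headSlot e) ≟ᵇ tail e ≡ true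
endSlots-correct = allᶠ-sound _ refl

nbr-tailSlot : ∀ e → nbr (tail e) (tailSlot e) ≡ head e
nbr-tailSlot e = ≟ᵇ-sound (∧-elimˡ (endSlots-correct e))

nbr-headSlot : ∀ e → nbr (head e) (headSlot e) ≡ tail e
nbr-headSlot e = ≟ᵇ-sound (∧-elimʳ {nbr (tail e) (tailSlot e) ≟ᵇ head e} (endSlots-correct e))

petersen-simple : IsSimple petersen
petersen-simple = record
  { symm = λ u v → ∨-comm (isPetEdge (Fin.toℕ u) (Fin.toℕ v)) (isPetEdge (Fin.toℕ v) (Fin.toℕ u))
  ; irrefl = λ u → not-true (allᶠ-sound (λ u → not (petersen u u)) refl u) }

petersen-edge : ∀ e → petersen (tail e) (head e) ≡ true
petersen-edge e = subst (λ z → petersen (tail e) z ≡ true) (nbr-tailSlot e) (nbr-adjacent (tail e) (tailSlot e))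

module _ (O : Orientation petersen) where

  arc-nbr : ∀ {w y} → arc O w y ≡ true → ∃ λ i → y ≡ nbr w i
  arc-nbr {w} {y} e = adjacent-nbr w y (onEdges O w y e)

  arc-into-nbr : ∀ {w y} → arc O y w ≡ true → ∃ λ i → y ≡ nbr w i
  arc-into-nbr {w} {y} e = adjacent-nbr w y (trans (IsSimple.symm petersen-simple w y) (onEdges O y w e))

  arc-from-nbr : ∀ w i → arc O (nbr w i) w ≡ not (arc O w (nbr w i))
  arc-from-nbr w i = exactlyOne O (nbr w i) w (trans (IsSimple.symm petersen-simple (nbr w i) w) (nbr-adjacent w i))

  nbr-≢ : ∀ w i → nbr w i ≢ w
  nbr-≢ w i eq = false≢true (trans (sym (IsSimple.irrefl petersen-simple w))
                                   (subst (λ z → petersen w z ≡ true) eq (nbr-adjacent w i)))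

  noArcsOut-except : ∀ u v w ex → removeEdge (arc O) u v w (nbr w ex) ≡ false →
    (∀ i → i ≢ ex → arc O w (nbr w i) ≡ false) → ∀ y → removeEdge (arc O) u v w y ≡ false
  noArcsOut-except u v w ex removed others y with arc O w y in e
  ... | false = refl
  ... | true with arc-nbr e
  ...   | i , refl with i ≟ ex
  ...     | yes refl = subst (λ b → b ∧ _ ≡ false) e removed
  ...     | no i≢ex = ⊥-elim (false≢true (trans (sym (others i i≢ex)) e))

  noArcsInto-except : ∀ u v w ex → removeEdge (arc O) u v (nbr w ex) w ≡ false →
    (∀ i → i ≢ ex → arc O w (nbr w i) ≡ true) → ∀ y → removeEdge (arc O) u v y w ≡ false
  noArcsInto-except u v w ex removed others y with arc O y w in e
  ... | false = refl
  ... | true with arc-into-nbr e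
  ...   | i , refl with i ≟ ex
  ...     | yes refl = subst (λ b → b ∧ _ ≡ false) e removed
  ...     | no i≢ex = ⊥-elim (false≢true (trans (sym (trans (arc-from-nbr w i) (cong not (others i i≢ex)))) e))

  SourceOrSink : Set
  SourceOrSink = ∃ λ w → (∀ i → arc O w (nbr w i) ≡ true) ⊎ (∀ i → arc O w (nbr w i) ≡ false)

  SourceOrSink⇒¬Deletable : SourceOrSink → ∀ u v → ¬ Deletable O u v
  SourceOrSink⇒¬Deletable (w , inj₁ out) u v d =
    noArcsInto⇒¬Reach (removeEdge (arc O) u v) w noneIn (nbr-≢ w 0F) (d (nbr w 0F) w)
    where
    noneIn : ∀ y → removeEdge (arc O) u v y w ≡ false
    noneIn y with arc O y w in e
    ... | false = refl
    ... | true with arc-into-nbr e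
    ...   | i , refl = ⊥-elim (false≢true (trans (sym (trans (arc-from-nbr w i) (cong not (out i)))) e))
  SourceOrSink⇒¬Deletable (w , inj₂ into) u v d =
    noArcsOutOf⇒¬Reach (removeEdge (arc O) u v) w noneOut (nbr-≢ w 0F) (d w (nbr w 0F))
    where
    noneOut : ∀ y → removeEdge (arc O) u v w y ≡ false
    noneOut y with arc O w y in e
    ... | false = refl
    ... | true with arc-nbr e
    ...   | i , refl = ⊥-elim (false≢true (trans (sym (into i)) e))

TwoOrientations : Set
TwoOrientations = Fin 2 → Orientation petersen

IsTwoCover : TwoOrientations → Set
IsTwoCover Os = ∀ u v → petersen u v ≡ true → ∃ λ (i : Fin 2) → Deletable (Os i) u v

-- Partial knowledge of two orientations: slot M o w i records the direction of the
-- arc from w to its i-th neighbour in orientation o (true = leaving w).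
Slots : Set
Slots = Vec (Vec (Vec (Maybe Bool) 3) 10) 2

slot : Slots → Fin 2 → Fin 10 → Fin 3 → Maybe Bool
slot M o w i = lookup (lookup (lookup M o) w) i

edgeDirection : TwoOrientations → Fin 2 × Fin 15 → Bool
edgeDirection Os (o , e) = arc (Os o) (tail e) (head e)

SlotsAgree : TwoOrientations → Slots → Set
SlotsAgree Os M = ∀ o w i b → slot M o w i ≡ just b → arc (Os o) w (nbr w i) ≡ b

setSlot : Slots → Fin 2 → Fin 10 → Fin 3 → Bool → Slots
setSlot M o w i b = updateAt M o (λ v → updateAt v w (λ r → r [ i ]≔ just b))

setEdgeDirection : Slots → Fin 2 × Fin 15 → Bool → Slots
setEdgeDirection M (o , e) b = setSlot (setSlot M o (tail e) (tailSlot e) b) o (head e) (headSlot e) (not b)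

noSlots : Slots
noSlots = replicate 2 (replicate 10 (replicate 3 nothing))

othersKnown : Slots → Fin 2 → Fin 10 → Fin 3 → Bool → Bool
othersKnown M o w ex true = allᶠ (λ i → i ≟ᵇ ex ∨ is-just-true (slot M o w i))
othersKnown M o w ex false = allᶠ (λ i → i ≟ᵇ ex ∨ is-just-false (slot M o w i))

-- Deleting the directed edge f leaves its tail without out-arcs or its head without in-arcs.
trapped : Slots → Fin 2 → Fin 15 → Maybe Bool → Bool
trapped M o f (just true) = othersKnown M o (tail f) (tailSlot f) false ∨ othersKnown M o (head f) (headSlot f) true
trapped M o f (just false) = othersKnown M o (head f) (headSlot f) false ∨ othersKnown M o (tail f) (tailSlot f) true
trapped M o f nothing = false

blocked : Slots → Fin 2 → Fin 15 → Bool → Bool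
blocked M o f sourceOrSink = sourceOrSink ∨ trapped M o f (slot M o (tail f) (tailSlot f))

uniformAt : Slots → Fin 2 → Fin 10 → Bool
uniformAt M o w = allᶠ (λ i → is-just-true (slot M o w i)) ∨ allᶠ (λ i → is-just-false (slot M o w i))

blockedInBoth : Slots → Fin 15 → Bool → Bool → Bool
blockedInBoth M e sourceOrSink₀ sourceOrSink₁ =
  anyᴸ (incident e) (λ f → blocked M 0F f sourceOrSink₀ ∧ blocked M 1F f sourceOrSink₁)

-- Only edges next to the one just assigned can have become blocked.
refutedSlots : Fin 2 × Fin 15 → Slots → Bool
refutedSlots (_ , e) M = blockedInBoth M e (uniformAt M 0F (tail e) ∨ uniformAt M 0F (head e))
                                           (uniformAt M 1F (tail e) ∨ uniformAt M 1F (head e))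

slot-setSlot : ∀ M o w i b o′ w′ i′ c → slot (setSlot M o w i b) o′ w′ i′ ≡ just c →
               (o′ ≡ o × w′ ≡ w × i′ ≡ i × b ≡ c) ⊎ slot M o′ w′ i′ ≡ just c
slot-setSlot M o w i b o′ w′ i′ c e with o′ ≟ o
... | no o′≢o rewrite lookup∘updateAt′ o′ o {f = λ v → updateAt v w (λ r → r [ i ]≔ just b)} o′≢o M = inj₂ e
... | yes refl rewrite lookup∘updateAt o′ {f = λ v → updateAt v w (λ r → r [ i ]≔ just b)} M with w′ ≟ w
...   | no w′≢w rewrite lookup∘updateAt′ w′ w {f = λ r → r [ i ]≔ just b} w′≢w (lookup M o′) = inj₂ e
...   | yes refl rewrite lookup∘updateAt w′ {f = λ r → r [ i ]≔ just b} (lookup M o′) with i′ ≟ i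
...     | yes refl rewrite lookup∘update i′ (lookup (lookup M o′) w′) (just b) with e
...       | refl = inj₁ (refl , refl , refl , refl)
slot-setSlot M o w i b o′ w′ i′ c e | yes refl | yes refl | no i′≢i
  rewrite lookup∘update′ i′≢i (lookup (lookup M o′) w′) (just b) = inj₂ e

setSlot-agrees : ∀ Os M o w i b → SlotsAgree Os M → arc (Os o) w (nbr w i) ≡ b → SlotsAgree Os (setSlot M o w i b)
setSlot-agrees Os M o w i b ag ab o′ w′ i′ c e with slot-setSlot M o w i b o′ w′ i′ c e
... | inj₁ (refl , refl , refl , refl) = ab
... | inj₂ e′ = ag o′ w′ i′ c e′

setEdgeDirection-agrees : ∀ Os M p b → SlotsAgree Os M → edgeDirection Os p ≡ b → SlotsAgree Os (setEdgeDirection M p b)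
setEdgeDirection-agrees Os M (o , e) b ag dir =
  setSlot-agrees Os (setSlot M o (tail e) (tailSlot e) b) o (head e) (headSlot e) (not b)
    (setSlot-agrees Os M o (tail e) (tailSlot e) b ag (trans (cong (arc (Os o) (tail e)) (nbr-tailSlot e)) dir))
    (trans (cong (arc (Os o) (head e)) (nbr-headSlot e)) (trans backwards (cong not dir)))
  where
  backwards : arc (Os o) (head e) (tail e) ≡ not (arc (Os o) (tail e) (head e))
  backwards = exactlyOne (Os o) (head e) (tail e) (trans (IsSimple.symm petersen-simple (head e) (tail e)) (petersen-edge e))

noSlots-agree : ∀ Os → SlotsAgree Os noSlots
noSlots-agree Os o w i b e
  rewrite lookup-replicate o (replicate 10 (replicate 3 (nothing {A = Bool})))
        | lookup-replicate w (replicate 3 (nothing {A = Bool}))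
        | lookup-replicate i (nothing {A = Bool}) with e
... | ()

module _ (Os : TwoOrientations) (M : Slots) (ag : SlotsAgree Os M) where

  othersKnown-sound : ∀ o w ex c → othersKnown M o w ex c ≡ true → ∀ i → i ≢ ex → arc (Os o) w (nbr w i) ≡ c
  othersKnown-sound o w ex true e i i≢ex with allᶠ-sound (λ i → i ≟ᵇ ex ∨ is-just-true (slot M o w i)) e i
  ... | r rewrite ≟ᵇ-≢ i≢ex = ag o w i true (is-just-true-sound r)
  othersKnown-sound o w ex false e i i≢ex with allᶠ-sound (λ i → i ≟ᵇ ex ∨ is-just-false (slot M o w i)) e i
  ... | r rewrite ≟ᵇ-≢ i≢ex = ag o w i false (is-just-false-sound r)

  uniformAt-sound : ∀ o w → uniformAt M o w ≡ true → SourceOrSink (Os o)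
  uniformAt-sound o w e with ∨-elim {allᶠ (λ i → is-just-true (slot M o w i))} e
  ... | inj₁ out = w , inj₁ (λ i → ag o w i true (is-just-true-sound (allᶠ-sound (λ i → is-just-true (slot M o w i)) out i)))
  ... | inj₂ into = w , inj₂ (λ i → ag o w i false (is-just-false-sound (allᶠ-sound (λ i → is-just-false (slot M o w i)) into i)))

  module _ (o : Fin 2) (f : Fin 15) where
    private
      O : Orientation petersen
      O = Os o
      u v : Fin 10
      u = tail f
      v = head f
      R : Adj 10
      R = removeEdge (arc O) u v
      v≢u : v ≢ u
      v≢u eq = nbr-≢ O u (tailSlot f) (trans (nbr-tailSlot f) eq)
      u≢v : u ≢ v
      u≢v eq = v≢u (sym eq)
      removed-tail-out : R u (nbr u (tailSlot f)) ≡ false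
      removed-tail-out = subst (λ z → R u z ≡ false) (sym (nbr-tailSlot f)) (removeEdge-removes (arc O) u v)
      removed-head-in : R (nbr v (headSlot f)) v ≡ false
      removed-head-in = subst (λ z → R z v ≡ false) (sym (nbr-headSlot f)) (removeEdge-removes (arc O) u v)
      removed-head-out : R v (nbr v (headSlot f)) ≡ false
      removed-head-out = subst (λ z → R v z ≡ false) (sym (nbr-headSlot f)) (removeEdge-removes-reverse (arc O) u v)
      removed-tail-in : R (nbr u (tailSlot f)) u ≡ false
      removed-tail-in = subst (λ z → R z u ≡ false) (sym (nbr-tailSlot f)) (removeEdge-removes-reverse (arc O) u v)

    trapped-sound : ∀ d → trapped M o f d ≡ true → ¬ Deletable O u v
    trapped-sound (just true) e d with ∨-elim {othersKnown M o u (tailSlot f) false} e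
    ... | inj₁ tail-in = noArcsOutOf⇒¬Reach R u
          (noArcsOut-except O u v u (tailSlot f) removed-tail-out (othersKnown-sound o u (tailSlot f) false tail-in)) v≢u (d u v)
    ... | inj₂ head-out = noArcsInto⇒¬Reach R v
          (noArcsInto-except O u v v (headSlot f) removed-head-in (othersKnown-sound o v (headSlot f) true head-out)) u≢v (d u v)
    trapped-sound (just false) e d with ∨-elim {othersKnown M o v (headSlot f) false} e
    ... | inj₁ head-in = noArcsOutOf⇒¬Reach R v
          (noArcsOut-except O u v v (headSlot f) removed-head-out (othersKnown-sound o v (headSlot f) false head-in)) u≢v (d v u)
    ... | inj₂ tail-out = noArcsInto⇒¬Reach R u
          (noArcsInto-except O u v u (tailSlot f) removed-tail-in (othersKnown-sound o u (tailSlot f) true tail-out)) v≢u (d v u)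

    blocked-sound : ∀ s → blocked M o f s ≡ true → (s ≡ true → SourceOrSink O) → ¬ Deletable O u v
    blocked-sound s e sourceOrSink with ∨-elim {s} e
    ... | inj₁ s≡true = SourceOrSink⇒¬Deletable O (sourceOrSink s≡true) u v
    ... | inj₂ stuck = trapped-sound (slot M o (tail f) (tailSlot f)) stuck

  endpointUniform-sound : ∀ o e → (uniformAt M o (tail e) ∨ uniformAt M o (head e)) ≡ true → SourceOrSink (Os o)
  endpointUniform-sound o e u with ∨-elim {uniformAt M o (tail e)} u
  ... | inj₁ u₁ = uniformAt-sound o (tail e) u₁
  ... | inj₂ u₂ = uniformAt-sound o (head e) u₂

  refutedSlots-sound : ∀ p → refutedSlots p M ≡ true → IsTwoCover Os → ⊥
  refutedSlots-sound (_ , e) r cover with anyᴸ-sound (incident e) _ r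
  ... | f , bl with cover (tail f) (head f) (petersen-edge f)
  ...   | 0F , d = blocked-sound 0F f _ (∧-elimˡ bl) (endpointUniform-sound 0F e) d
  ...   | 1F , d = blocked-sound 1F f _ (∧-elimʳ {blocked M 0F f (uniformAt M 0F (tail e) ∨ uniformAt M 0F (head e))} bl)
                     (endpointUniform-sound 1F e) d

slotAnalysis : (C : Set) (settles : Slots → C → Bool) →
               (∀ Os M c → settles M c ≡ true → SlotsAgree Os M → IsTwoCover Os → ⊥) → CaseAnalysis
slotAnalysis C settles settles-sound = record
  { Position = Fin 2 × Fin 15
  ; Partial = Slots
  ; Total = TwoOrientations
  ; Certificate = C
  ; Admissible = IsTwoCover
  ; Goal = λ _ → ⊥
  ; value = edgeDirection
  ; Agrees = SlotsAgree
  ; assign = setEdgeDirection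
  ; assign-agrees = λ Os M p _ ag → setEdgeDirection-agrees Os M p _ ag refl
  ; refuted = refutedSlots
  ; refuted-sound = λ Os M p r ag cover → refutedSlots-sound Os M ag p r cover
  ; settles = settles
  ; settles-sound = settles-sound }

assignAll : Slots → List ((Fin 2 × Fin 15) × Bool) → Slots
assignAll M [] = M
assignAll M ((p , b) ∷ rest) = assignAll (setEdgeDirection M p b) rest

assignAll-agrees : ∀ Os M as → SlotsAgree Os M → All (λ pb → edgeDirection Os (proj₁ pb) ≡ proj₂ pb) as →
                   SlotsAgree Os (assignAll M as)
assignAll-agrees Os M [] ag [] = ag
assignAll-agrees Os M ((p , b) ∷ rest) ag (dir ∷ dirs) =
  assignAll-agrees Os (setEdgeDirection M p b) rest (setEdgeDirection-agrees Os M p b ag dir) dirs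

-- At vertex 0 (edges 0, 4 and 5 lead to 1, 4 and 5): orientation 0 enters from 1
-- and leaves towards 4 and 5, orientation 1 enters from 4 and leaves towards 1 and 5.
normalAt0 : Fin 2 → Fin 3 → Bool
normalAt0 0F 0F = false
normalAt0 0F 1F = true
normalAt0 0F 2F = true
normalAt0 1F 0F = true
normalAt0 1F 1F = false
normalAt0 1F 2F = true

normalAssignment : List ((Fin 2 × Fin 15) × Bool)
normalAssignment = ((0F , # 0) , false) ∷ ((1F , # 0) , true) ∷ ((0F , # 4) , false) ∷
                   ((1F , # 4) , true) ∷ ((0F , # 5) , true) ∷ ((1F , # 5) , true) ∷ []

normalSlots : Slots
normalSlots = assignAll noSlots normalAssignment

edgesAt0 : List (Fin 2 × Fin 15)
edgesAt0 = List.map proj₁ normalAssignment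

otherEdges : List (Fin 2 × Fin 15)
otherEdges = List.concatMap (λ e → (0F , e) ∷ (1F , e) ∷ [])
  (List.filterᵇ (λ e → not (e ≟ᵇ # 0 ∨ e ≟ᵇ # 4 ∨ e ≟ᵇ # 5)) (List.allFin 15))

normal-¬IsTwoCover : ∀ Os → IsTwoCover Os → SlotsAgree Os normalSlots → ⊥
normal-¬IsTwoCover Os cover ag =
  CaseAnalysisCheck.check-sound (slotAnalysis ⊤ (λ _ _ → false) (λ _ _ _ ())) otherEdges normalSlots [] [] Os refl ag cover

-- An automorphism σ of the Petersen graph (with inverse τ) and a choice of which of
-- the two orientations to reverse, bringing vertex 0 into normal form.
record Normalisation : Set where
  constructor normalise
  field
    σ τ : Vec (Fin 10) 10
    reverse₀ reverse₁ : Bool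

isAutomorphismᵇ : (Fin 10 → Fin 10) → (Fin 10 → Fin 10) → Bool
isAutomorphismᵇ σ τ = allᶠ (λ a → τ (σ a) ≟ᵇ a) ∧ (allᶠ (λ b → σ (τ b) ≟ᵇ b) ∧
                      allᶠ (λ a → allᶠ (λ b → petersen a b == petersen (σ a) (σ b))))

reversal : Bool → Bool → Fin 2 → Bool
reversal r₀ r₁ 0F = r₀
reversal r₀ r₁ 1F = r₁

matches : Maybe Bool → Bool → Bool → Bool
matches (just b) r t = (if r then not b else b) == t
matches nothing r t = false

normalisesᵇ : Slots → (Fin 10 → Fin 10) → Bool → Bool → Bool
normalisesᵇ M τ r₀ r₁ = τ 0F ≟ᵇ 0F ∧ allᶠ (λ o → allᶠ (λ s → anyᶠ (λ s′ →
  nbr 0F s′ ≟ᵇ τ (nbr 0F s) ∧ matches (slot M o 0F s′) (reversal r₀ r₁ o) (normalAt0 o s))))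

normalisationCheck : Slots → Normalisation → Bool
normalisationCheck M (normalise σ τ r₀ r₁) = isAutomorphismᵇ (lookup σ) (lookup τ) ∧ normalisesᵇ M (lookup τ) r₀ r₁

module Normalised (Os : TwoOrientations) (M : Slots) (ag : SlotsAgree Os M) (cover : IsTwoCover Os)
                  (σv τv : Vec (Fin 10) 10) (r₀ r₁ : Bool)
                  (aut : isAutomorphismᵇ (lookup σv) (lookup τv) ≡ true) (nf : normalisesᵇ M (lookup τv) r₀ r₁ ≡ true) where
  σ τ : Fin 10 → Fin 10
  σ = lookup σv
  τ = lookup τv

  τσ : ∀ x → τ (σ x) ≡ x
  τσ x = ≟ᵇ-sound (allᶠ-sound (λ a → τ (σ a) ≟ᵇ a) (∧-elimˡ aut) x)

  στ : ∀ y → σ (τ y) ≡ y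
  στ y = ≟ᵇ-sound (allᶠ-sound (λ b → σ (τ b) ≟ᵇ b) (∧-elimˡ (∧-elimʳ {allᶠ (λ a → τ (σ a) ≟ᵇ a)} aut)) y)

  σ-preserves : ∀ a b → petersen a b ≡ petersen (σ a) (σ b)
  σ-preserves a b = ==-sound (allᶠ-sound (λ b → petersen a b == petersen (σ a) (σ b)) (allᶠ-sound (λ a → allᶠ (λ b → petersen a b == petersen (σ a) (σ b)))
    (∧-elimʳ {allᶠ (λ b → σ (τ b) ≟ᵇ b)} (∧-elimʳ {allᶠ (λ a → τ (σ a) ≟ᵇ a)} aut)) a) b)

  σ-automorphism : Isomorphic petersen petersen
  σ-automorphism = mkIsomorphic {H = petersen} σ τ τσ στ σ-preserves

  reversed : TwoOrientations
  reversed o = reverseIf petersen-simple (reversal r₀ r₁ o) (Os o)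

  normalised : TwoOrientations
  normalised o = orientation-transport σ-automorphism (reversed o)

  normalised-cover : IsTwoCover normalised
  normalised-cover u v e =
    let (i , d) = cover (τ u) (τ v) (trans (sym (Isomorphic-reflect σ-automorphism u v)) e)
    in i , Deletable-transport {H = petersen} σ-automorphism (reversed i) u v
             (reverseIf-Deletable petersen-simple (reversal r₀ r₁ i) (Os i) (τ u) (τ v) d)

  reversed-slot : ∀ o s′ r t d → slot M o 0F s′ ≡ d → matches d r t ≡ true →
                  arc (reverseIf petersen-simple r (Os o)) 0F (nbr 0F s′) ≡ t
  reversed-slot o s′ false t (just b) e m = trans (ag o 0F s′ b e) (==-sound m)
  reversed-slot o s′ true t (just b) e m = trans (arc-from-nbr (Os o) 0F s′) (trans (cong not (ag o 0F s′ b e)) (==-sound m))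

  normalised-at0 : ∀ o s → arc (normalised o) 0F (nbr 0F s) ≡ normalAt0 o s
  normalised-at0 o s =
    trans (cong₂ (arc (reversed o)) (≟ᵇ-sound (∧-elimˡ nf)) (sym (≟ᵇ-sound (∧-elimˡ found))))
          (reversed-slot o s′ (reversal r₀ r₁ o) (normalAt0 o s) _ refl (∧-elimʳ {nbr 0F s′ ≟ᵇ τ (nbr 0F s)} found))
    where
    candidate : Fin 3 → Bool
    candidate s′ = nbr 0F s′ ≟ᵇ τ (nbr 0F s) ∧ matches (slot M o 0F s′) (reversal r₀ r₁ o) (normalAt0 o s)
    witness : ∃ λ s′ → candidate s′ ≡ true
    witness = anyᶠ-sound candidate (allᶠ-sound (λ s → anyᶠ (λ s′ → nbr 0F s′ ≟ᵇ τ (nbr 0F s) ∧ matches (slot M o 0F s′) (reversal r₀ r₁ o) (normalAt0 o s))) (allᶠ-sound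
                (λ o → allᶠ (λ s → anyᶠ (λ s′ → nbr 0F s′ ≟ᵇ τ (nbr 0F s) ∧ matches (slot M o 0F s′) (reversal r₀ r₁ o) (normalAt0 o s))))
                (∧-elimʳ {τ 0F ≟ᵇ 0F} nf) o) s)
    s′ : Fin 3
    s′ = proj₁ witness
    found : candidate s′ ≡ true
    found = proj₂ witness

  edge4 : ∀ o → edgeDirection normalised (o , # 4) ≡ not (normalAt0 o 1F)
  edge4 o = trans (exactlyOne (normalised o) 4F 0F refl) (cong not (normalised-at0 o 1F))

  impossible : ⊥
  impossible = normal-¬IsTwoCover normalised normalised-cover
    (assignAll-agrees normalised noSlots normalAssignment (noSlots-agree normalised)
      (normalised-at0 0F 0F ∷ normalised-at0 1F 0F ∷ edge4 0F ∷ edge4 1F ∷ normalised-at0 0F 2F ∷ normalised-at0 1F 2F ∷ []))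

normalisations : List Normalisation
normalisations =
  normalise (0F Vec.∷ 4F Vec.∷ 3F Vec.∷ 2F Vec.∷ 1F Vec.∷ 5F Vec.∷ 9F Vec.∷ 8F Vec.∷ 7F Vec.∷ 6F Vec.∷ Vec.[]) (0F Vec.∷ 4F Vec.∷ 3F Vec.∷ 2F Vec.∷ 1F Vec.∷ 5F Vec.∷ 9F Vec.∷ 8F Vec.∷ 7F Vec.∷ 6F Vec.∷ Vec.[]) true false ∷
  normalise (0F Vec.∷ 1F Vec.∷ 2F Vec.∷ 3F Vec.∷ 4F Vec.∷ 5F Vec.∷ 6F Vec.∷ 7F Vec.∷ 8F Vec.∷ 9F Vec.∷ Vec.[]) (0F Vec.∷ 1F Vec.∷ 2F Vec.∷ 3F Vec.∷ 4F Vec.∷ 5F Vec.∷ 6F Vec.∷ 7F Vec.∷ 8F Vec.∷ 9F Vec.∷ Vec.[]) false true ∷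
  normalise (0F Vec.∷ 5F Vec.∷ 7F Vec.∷ 2F Vec.∷ 1F Vec.∷ 4F Vec.∷ 8F Vec.∷ 9F Vec.∷ 3F Vec.∷ 6F Vec.∷ Vec.[]) (0F Vec.∷ 4F Vec.∷ 3F Vec.∷ 8F Vec.∷ 5F Vec.∷ 1F Vec.∷ 9F Vec.∷ 2F Vec.∷ 6F Vec.∷ 7F Vec.∷ Vec.[]) true true ∷
  normalise (0F Vec.∷ 1F Vec.∷ 2F Vec.∷ 7F Vec.∷ 5F Vec.∷ 4F Vec.∷ 6F Vec.∷ 3F Vec.∷ 9F Vec.∷ 8F Vec.∷ Vec.[]) (0F Vec.∷ 1F Vec.∷ 2F Vec.∷ 7F Vec.∷ 5F Vec.∷ 4F Vec.∷ 6F Vec.∷ 3F Vec.∷ 9F Vec.∷ 8F Vec.∷ Vec.[]) false true ∷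
  normalise (0F Vec.∷ 5F Vec.∷ 7F Vec.∷ 9F Vec.∷ 4F Vec.∷ 1F Vec.∷ 8F Vec.∷ 2F Vec.∷ 6F Vec.∷ 3F Vec.∷ Vec.[]) (0F Vec.∷ 5F Vec.∷ 7F Vec.∷ 9F Vec.∷ 4F Vec.∷ 1F Vec.∷ 8F Vec.∷ 2F Vec.∷ 6F Vec.∷ 3F Vec.∷ Vec.[]) true true ∷
  normalise (0F Vec.∷ 4F Vec.∷ 3F Vec.∷ 8F Vec.∷ 5F Vec.∷ 1F Vec.∷ 9F Vec.∷ 2F Vec.∷ 6F Vec.∷ 7F Vec.∷ Vec.[]) (0F Vec.∷ 5F Vec.∷ 7F Vec.∷ 2F Vec.∷ 1F Vec.∷ 4F Vec.∷ 8F Vec.∷ 9F Vec.∷ 3F Vec.∷ 6F Vec.∷ Vec.[]) true false ∷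
  normalise (0F Vec.∷ 5F Vec.∷ 7F Vec.∷ 2F Vec.∷ 1F Vec.∷ 4F Vec.∷ 8F Vec.∷ 9F Vec.∷ 3F Vec.∷ 6F Vec.∷ Vec.[]) (0F Vec.∷ 4F Vec.∷ 3F Vec.∷ 8F Vec.∷ 5F Vec.∷ 1F Vec.∷ 9F Vec.∷ 2F Vec.∷ 6F Vec.∷ 7F Vec.∷ Vec.[]) true false ∷
  normalise (0F Vec.∷ 1F Vec.∷ 2F Vec.∷ 7F Vec.∷ 5F Vec.∷ 4F Vec.∷ 6F Vec.∷ 3F Vec.∷ 9F Vec.∷ 8F Vec.∷ Vec.[]) (0F Vec.∷ 1F Vec.∷ 2F Vec.∷ 7F Vec.∷ 5F Vec.∷ 4F Vec.∷ 6F Vec.∷ 3F Vec.∷ 9F Vec.∷ 8F Vec.∷ Vec.[]) false false ∷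
  normalise (0F Vec.∷ 4F Vec.∷ 3F Vec.∷ 2F Vec.∷ 1F Vec.∷ 5F Vec.∷ 9F Vec.∷ 8F Vec.∷ 7F Vec.∷ 6F Vec.∷ Vec.[]) (0F Vec.∷ 4F Vec.∷ 3F Vec.∷ 2F Vec.∷ 1F Vec.∷ 5F Vec.∷ 9F Vec.∷ 8F Vec.∷ 7F Vec.∷ 6F Vec.∷ Vec.[]) true true ∷
  normalise (0F Vec.∷ 1F Vec.∷ 2F Vec.∷ 3F Vec.∷ 4F Vec.∷ 5F Vec.∷ 6F Vec.∷ 7F Vec.∷ 8F Vec.∷ 9F Vec.∷ Vec.[]) (0F Vec.∷ 1F Vec.∷ 2F Vec.∷ 3F Vec.∷ 4F Vec.∷ 5F Vec.∷ 6F Vec.∷ 7F Vec.∷ 8F Vec.∷ 9F Vec.∷ Vec.[]) false false ∷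
  normalise (0F Vec.∷ 4F Vec.∷ 3F Vec.∷ 8F Vec.∷ 5F Vec.∷ 1F Vec.∷ 9F Vec.∷ 2F Vec.∷ 6F Vec.∷ 7F Vec.∷ Vec.[]) (0F Vec.∷ 5F Vec.∷ 7F Vec.∷ 2F Vec.∷ 1F Vec.∷ 4F Vec.∷ 8F Vec.∷ 9F Vec.∷ 3F Vec.∷ 6F Vec.∷ Vec.[]) true true ∷
  normalise (0F Vec.∷ 5F Vec.∷ 7F Vec.∷ 9F Vec.∷ 4F Vec.∷ 1F Vec.∷ 8F Vec.∷ 2F Vec.∷ 6F Vec.∷ 3F Vec.∷ Vec.[]) (0F Vec.∷ 5F Vec.∷ 7F Vec.∷ 9F Vec.∷ 4F Vec.∷ 1F Vec.∷ 8F Vec.∷ 2F Vec.∷ 6F Vec.∷ 3F Vec.∷ Vec.[]) true false ∷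
  normalise (0F Vec.∷ 5F Vec.∷ 7F Vec.∷ 9F Vec.∷ 4F Vec.∷ 1F Vec.∷ 8F Vec.∷ 2F Vec.∷ 6F Vec.∷ 3F Vec.∷ Vec.[]) (0F Vec.∷ 5F Vec.∷ 7F Vec.∷ 9F Vec.∷ 4F Vec.∷ 1F Vec.∷ 8F Vec.∷ 2F Vec.∷ 6F Vec.∷ 3F Vec.∷ Vec.[]) false true ∷
  normalise (0F Vec.∷ 4F Vec.∷ 3F Vec.∷ 8F Vec.∷ 5F Vec.∷ 1F Vec.∷ 9F Vec.∷ 2F Vec.∷ 6F Vec.∷ 7F Vec.∷ Vec.[]) (0F Vec.∷ 5F Vec.∷ 7F Vec.∷ 2F Vec.∷ 1F Vec.∷ 4F Vec.∷ 8F Vec.∷ 9F Vec.∷ 3F Vec.∷ 6F Vec.∷ Vec.[]) false false ∷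
  normalise (0F Vec.∷ 1F Vec.∷ 2F Vec.∷ 3F Vec.∷ 4F Vec.∷ 5F Vec.∷ 6F Vec.∷ 7F Vec.∷ 8F Vec.∷ 9F Vec.∷ Vec.[]) (0F Vec.∷ 1F Vec.∷ 2F Vec.∷ 3F Vec.∷ 4F Vec.∷ 5F Vec.∷ 6F Vec.∷ 7F Vec.∷ 8F Vec.∷ 9F Vec.∷ Vec.[]) true true ∷
  normalise (0F Vec.∷ 4F Vec.∷ 3F Vec.∷ 2F Vec.∷ 1F Vec.∷ 5F Vec.∷ 9F Vec.∷ 8F Vec.∷ 7F Vec.∷ 6F Vec.∷ Vec.[]) (0F Vec.∷ 4F Vec.∷ 3F Vec.∷ 2F Vec.∷ 1F Vec.∷ 5F Vec.∷ 9F Vec.∷ 8F Vec.∷ 7F Vec.∷ 6F Vec.∷ Vec.[]) false false ∷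
  normalise (0F Vec.∷ 1F Vec.∷ 2F Vec.∷ 7F Vec.∷ 5F Vec.∷ 4F Vec.∷ 6F Vec.∷ 3F Vec.∷ 9F Vec.∷ 8F Vec.∷ Vec.[]) (0F Vec.∷ 1F Vec.∷ 2F Vec.∷ 7F Vec.∷ 5F Vec.∷ 4F Vec.∷ 6F Vec.∷ 3F Vec.∷ 9F Vec.∷ 8F Vec.∷ Vec.[]) true true ∷
  normalise (0F Vec.∷ 5F Vec.∷ 7F Vec.∷ 2F Vec.∷ 1F Vec.∷ 4F Vec.∷ 8F Vec.∷ 9F Vec.∷ 3F Vec.∷ 6F Vec.∷ Vec.[]) (0F Vec.∷ 4F Vec.∷ 3F Vec.∷ 8F Vec.∷ 5F Vec.∷ 1F Vec.∷ 9F Vec.∷ 2F Vec.∷ 6F Vec.∷ 7F Vec.∷ Vec.[]) false true ∷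
  normalise (0F Vec.∷ 4F Vec.∷ 3F Vec.∷ 8F Vec.∷ 5F Vec.∷ 1F Vec.∷ 9F Vec.∷ 2F Vec.∷ 6F Vec.∷ 7F Vec.∷ Vec.[]) (0F Vec.∷ 5F Vec.∷ 7F Vec.∷ 2F Vec.∷ 1F Vec.∷ 4F Vec.∷ 8F Vec.∷ 9F Vec.∷ 3F Vec.∷ 6F Vec.∷ Vec.[]) false true ∷
  normalise (0F Vec.∷ 5F Vec.∷ 7F Vec.∷ 9F Vec.∷ 4F Vec.∷ 1F Vec.∷ 8F Vec.∷ 2F Vec.∷ 6F Vec.∷ 3F Vec.∷ Vec.[]) (0F Vec.∷ 5F Vec.∷ 7F Vec.∷ 9F Vec.∷ 4F Vec.∷ 1F Vec.∷ 8F Vec.∷ 2F Vec.∷ 6F Vec.∷ 3F Vec.∷ Vec.[]) false false ∷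
  normalise (0F Vec.∷ 1F Vec.∷ 2F Vec.∷ 7F Vec.∷ 5F Vec.∷ 4F Vec.∷ 6F Vec.∷ 3F Vec.∷ 9F Vec.∷ 8F Vec.∷ Vec.[]) (0F Vec.∷ 1F Vec.∷ 2F Vec.∷ 7F Vec.∷ 5F Vec.∷ 4F Vec.∷ 6F Vec.∷ 3F Vec.∷ 9F Vec.∷ 8F Vec.∷ Vec.[]) true false ∷
  normalise (0F Vec.∷ 5F Vec.∷ 7F Vec.∷ 2F Vec.∷ 1F Vec.∷ 4F Vec.∷ 8F Vec.∷ 9F Vec.∷ 3F Vec.∷ 6F Vec.∷ Vec.[]) (0F Vec.∷ 4F Vec.∷ 3F Vec.∷ 8F Vec.∷ 5F Vec.∷ 1F Vec.∷ 9F Vec.∷ 2F Vec.∷ 6F Vec.∷ 7F Vec.∷ Vec.[]) false false ∷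
  normalise (0F Vec.∷ 1F Vec.∷ 2F Vec.∷ 3F Vec.∷ 4F Vec.∷ 5F Vec.∷ 6F Vec.∷ 7F Vec.∷ 8F Vec.∷ 9F Vec.∷ Vec.[]) (0F Vec.∷ 1F Vec.∷ 2F Vec.∷ 3F Vec.∷ 4F Vec.∷ 5F Vec.∷ 6F Vec.∷ 7F Vec.∷ 8F Vec.∷ 9F Vec.∷ Vec.[]) true false ∷
  normalise (0F Vec.∷ 4F Vec.∷ 3F Vec.∷ 2F Vec.∷ 1F Vec.∷ 5F Vec.∷ 9F Vec.∷ 8F Vec.∷ 7F Vec.∷ 6F Vec.∷ Vec.[]) (0F Vec.∷ 4F Vec.∷ 3F Vec.∷ 2F Vec.∷ 1F Vec.∷ 5F Vec.∷ 9F Vec.∷ 8F Vec.∷ 7F Vec.∷ 6F Vec.∷ Vec.[]) false true ∷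
  []

petersen-¬Covers-2 : ¬ Covers petersen 2
petersen-¬Covers-2 (Os , cover) =
  CaseAnalysisCheck.check-sound (slotAnalysis Normalisation normalisationCheck impossible) edgesAt0 noSlots normalisations []
    Os refl (noSlots-agree Os) cover
  where
  impossible : ∀ Os M c → normalisationCheck M c ≡ true → SlotsAgree Os M → IsTwoCover Os → ⊥
  impossible Os M (normalise σ τ r₀ r₁) e ag cover =
    Normalised.impossible Os M ag cover σ τ r₀ r₁ (∧-elimˡ e) (∧-elimʳ {isAutomorphismᵇ (lookup σ) (lookup τ)} e)

certificates : ℕ → List Certificate
certificates 0 =
  orientations 0 0 ∷
  []
certificates 1 =
  orientations 0 0 ∷
  []
certificates 2 =
  []
certificates 3 =
  []
certificates 4 =
  orientations 8 132 ∷
  []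
certificates 5 =
  []
certificates 6 =
  orientations 67586 4392964 ∷
  orientations 541097996 537035780 ∷
  orientations 8421388 100356 ∷
  orientations 8389130 132610 ∷
  orientations 131334 8389890 ∷
  []
certificates 7 =
  []
certificates 8 =
  orientations 3225419784 550829563914 ∷
  orientations 3229614088 277025398794 ∷
  orientations 552444362760 70919036866570 ∷
  orientations 139590635528 36028797560029196 ∷
  orientations 276496908296 141012903137290 ∷
  orientations 36028935540051976 545259532 ∷
  orientations 140739908468744 141012634705930 ∷
  orientations 2151686152 36028934730547212 ∷
  orientations 70370094743560 70918768435210 ∷
  orientations 36028798101102600 137715777548 ∷
  orientations 70919305302024 550032637964 ∷
  orientations 141013171576840 140738033614860 ∷
  orientations 277031682052 141012368363526 ∷
  orientations 36028936609599492 2149580812 ∷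
  orientations 2151686154 551905406978 ∷
  orientations 551907495938 70370891669514 ∷
  orientations 2147495938 140737492557830 ∷
  orientations 140737490464774 550030544900 ∷
  orientations 70370896904196 70918501048326 ∷
  orientations 36028799170650116 139587485708 ∷
  orientations 2147495938 549760012294 ∷
  orientations 140739640041474 277025394698 ∷
  orientations 549756874758 140738030477316 ∷
  orientations 2151682058 140739636899842 ∷
  orientations 70918503141380 551904346124 ∷
  orientations 141012369416196 140739637936140 ∷
  orientations 211655988355074 140737492557832 ∷
  orientations 36099305353773064 36029484217929732 ∷
  orientations 36029074048548872 36169534511521796 ∷
  twoEdgeCut 0 1 6 7 1 ∷
  orientations 141012903665670 36029071896883202 ∷
  orientations 70918768955398 36099165763153922 ∷
  orientations 141012368367626 36029071897407490 ∷
  orientations 70918501044234 36099165763678210 ∷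
  orientations 70920647479304 211930868355074 ∷
  orientations 551903301640 36029484217929730 ∷
  orientations 36169671950467076 36029209340022792 ∷
  orientations 36028798096902150 549762105348 ∷
  orientations 140738027325446 549762105348 ∷
  twoEdgeCut 0 2 4 7 2 ∷
  orientations 70918501044236 36099165766289412 ∷
  twoEdgeCut 1 4 2 5 4 ∷
  orientations 277025390600 71195525386244 ∷
  orientations 36099303204196356 36029485287477250 ∷
  orientations 140874929410052 414464348162 ∷
  orientations 140738027324426 551366426632 ∷
  orientations 550024253452 140738830533640 ∷
  twoEdgeCut 0 3 4 7 3 ∷
  twoEdgeCut 1 4 3 5 4 ∷
  twoEdgeCut 2 4 3 5 4 ∷
  []
certificates 9 =
  []
certificates 10 =
  orientations 148294810279910342666 295292021192196653064 ∷
  orientations 148006861653613248522 590439926371549478920 ∷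
  orientations 147646573408545701898 577305452245729282 ∷
  orientations 147646292208446898186 289075350971924482 ∷
  orientations 590512265440497008648 302821895392428973621252 ∷
  orientations 295364641736120893448 604758202109706815668228 ∷
  twoEdgeCut 0 2 1 5 2 ∷
  orientations 147862886928147824650 295148046741609136136 ∷
  orientations 295148468954074202120 590584744697177063426 ∷
  orientations 302231455044944739188740 295220666460899655682 ∷
  petersenLabels (0 ∷ 1 ∷ 4 ∷ 5 ∷ 2 ∷ 6 ∷ 9 ∷ 3 ∷ 8 ∷ 7 ∷ []) ∷
  orientations 563224965545996 604463198741378382184454 ∷
  orientations 72620544125616130 147934241109823225860 ∷
  orientations 618970314863356598349217798 563499910578180 ∷
  orientations 148150836104200732682 590295951920961961992 ∷
  orientations 590296092658450317320 295724788693877145602 ∷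
  orientations 282024866742284 302232031786622263508998 ∷
  petersenLabels (0 ∷ 1 ∷ 4 ∷ 5 ∷ 2 ∷ 6 ∷ 9 ∷ 3 ∷ 7 ∷ 8 ∷ []) ∷
  orientations 618970019715029206598467586 618970167865161348546592772 ∷
  orientations 604462909948327154958340 590368290165275770882 ∷
  orientations 618970610082897159274905606 590512124428130762754 ∷
  orientations 148150483985601937418 865254353420730370 ∷
  orientations 295147976098054160388 302231599652164201365506 ∷
  orientations 563224898437132 590584674053756305414 ∷
  petersenLabels (0 ∷ 1 ∷ 4 ∷ 5 ∷ 2 ∷ 6 ∷ 3 ∷ 9 ∷ 8 ∷ 7 ∷ []) ∷
  orientations 618970019930990882479718402 618970167217276320902823940 ∷
  orientations 302231455467431947943944 604463198671284314587138 ∷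
  orientations 619272251242342301650927622 563499910578180 ∷
  orientations 147862253884328132618 864973153321926658 ∷
  petersenLabels (0 ∷ 1 ∷ 4 ∷ 5 ∷ 2 ∷ 6 ∷ 3 ∷ 9 ∷ 7 ∷ 8 ∷ []) ∷
  orientations 282024799633420 295724717775578480646 ∷
  orientations 576531121181868034 147574304983354458116 ∷
  orientations 590295881002529079300 604463054274346518331394 ∷
  orientations 604462910089614264909832 302232031716803073818626 ∷
  orientations 619574482624836521185787910 604463126051015335395330 ∷
  orientations 590584252665790742536 302822327315780736122884 ∷
  orientations 295724577862589628424 604758346084157403168772 ∷
  twoEdgeCut 0 2 1 4 2 ∷
  orientations 618970315511241625992986630 576461302260596740 ∷
  orientations 618970610226871609862422534 590440137202837012482 ∷
  orientations 619272251746252878707195910 576461302260596740 ∷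
  orientations 619574482840798197067055110 604462982076564747894786 ∷
  twoEdgeCut 0 1 3 9 1 ∷
  orientations 590584041559491117064 302231743169767707557890 ∷
  orientations 604610771991105049231368 443010123879376011266 ∷
  orientations 302821750749750261448716 563774721392648 ∷
  orientations 618970314934746239140364300 442722456453311905796 ∷
  orientations 604758057748228135190540 563774654283784 ∷
  orientations 619272398743639712652591116 302231455502341576343556 ∷
  orientations 302379605317823907266568 738446259160002641922 ∷
  orientations 295724366756290002952 604463486303526275039234 ∷
  twoEdgeCut 0 1 3 8 1 ∷
  orientations 604758057747953324392460 282299744681992 ∷
  orientations 590439961006165721100 618970757512770020259676164 ∷
  orientations 302821750749475316432908 282299677573128 ∷
  orientations 604610555852957618798604 619574482552814386464964612 ∷
  orientations 295147940913614946316 303116898760482797682692 ∷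
  orientations 148150449076241956876 618970019642866884077961224 ∷
  orientations 590295845818089865228 605348353663865213452292 ∷
  orientations 618970167504908562661900300 176746628399112 ∷
  twoEdgeCut 0 1 2 7 1 ∷
  orientations 590367867952944939012 302231526996985593774082 ∷
  orientations 618970314862652911041675268 619574482624590505459105794 ∷
  orientations 302231454939391488688140 906989512687069935206404 ∷
  orientations 576496486498435084 618970167216749104943087624 ∷
  orientations 604462909842773904457740 907284660591974410125316 ∷
  orientations 618970019930955972918378508 147574058967493525512 ∷
  orientations 619272251241708983020453892 618970610082651143548223490 ∷
  orientations 604463053922502864568324 295292056101623742466 ∷
  twoEdgeCut 0 1 2 6 1 ∷
  orientations 590584885297427791876 288793326239399942 ∷
  orientations 590872552586120052738 590439925821860773892 ∷
  orientations 302232103422141074014218 302232031927634562646028 ∷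
  orientations 577305314739634178 604463558607548222308362 ∷
  orientations 844425064366086 577023839762907148 ∷
  orientations 590296091971188424716 590368712652551634954 ∷
  orientations 618970610010558365205299208 590368431040337281036 ∷
  orientations 590584603684945051650 590295951371273256964 ∷
  orientations 618970314863215998232739842 618970314790736466674728968 ∷
  orientations 590656239066450788358 618970019930920788680507396 ∷
  orientations 618970609938782108638003204 618970020219432777180774412 ∷
  orientations 302231455537113430245386 302232031927634562646028 ∷
  orientations 865254215914651650 604463198671421753540618 ∷
  orientations 864691128589385734 577023839762907148 ∷
  orientations 618970315367126575288991746 618970314934710917262245896 ∷
  orientations 618970610226731009813020676 618970019931483876005773324 ∷
  orientations 619272251170285119929860104 302231527524338724028426 ∷
  orientations 618970019642760781205864460 618970019931553832365998086 ∷
  orientations 590584040872363425804 591160572130782904330 ∷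
  orientations 590440277390569521158 618970019642971887505506308 ∷
  orientations 618970019714748006499614732 618970020291489958834765830 ∷
  orientations 618970609938571139911532552 590872341617393532940 ∷
  twoEdgeCut 0 1 6 9 1 ∷
  twoEdgeCut 0 1 8 9 1 ∷
  orientations 590584075919296610306 605348641753366303637508 ∷
  orientations 590296373446165168136 618970757512488545148731404 ∷
  orientations 590296408630470131722 618970019643253499854061576 ∷
  orientations 619272251098157019708817412 618970609938535955472318476 ∷
  orientations 618970314862688370090360834 619574482624555321087000584 ∷
  orientations 590296091833749520386 605348353839649500708868 ∷
  orientations 590872306432887242760 618970757512453360776642572 ∷
  orientations 604462910088927070126092 619574482552814111519948806 ∷
  orientations 590872271248448061450 618970020219186486576152584 ∷
  orientations 619272251674090006430892036 618970609938500771100229644 ∷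
  orientations 618970314790665960424521730 619574482552603280165322760 ∷
  orientations 604462909877958343655436 605053205723363848241162 ∷
  orientations 604610772834774266429444 147862745915848704006 ∷
  orientations 577305246087266306 591016668117659058186 ∷
  orientations 295868481188451614730 295724929156554686476 ∷
  orientations 147574797014673670150 148150976360786952204 ∷
  orientations 604462910088858417758220 604463054767202471264266 ∷
  orientations 604463486549541934645250 604462981865183704547332 ∷
  orientations 619574482696612915057819656 604463054485521537433612 ∷
  orientations 865254147262283778 590584744765896540170 ∷
  orientations 295148608935514095626 295724929156554686476 ∷
  orientations 148438643718198689798 148150976360786952204 ∷
  orientations 618970314935414535984529416 295292583386101628938 ∷
  orientations 618970019642831149882933260 618970019931624201177284614 ∷
  orientations 619272251674195353254543362 619272251169651732512800776 ∷
  orientations 619574482840727897042354180 618970019931483807219187724 ∷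
  orientations 604463198037759592759308 604463774639455408783370 ∷
  orientations 618970019786805600470433804 618970020363547552939802630 ∷
  orientations 604462982287121224581126 618970019642971887505506308 ∷
  orientations 604463198600640759644162 604462909877958410780676 ∷
  orientations 619272251242272001492041730 619272251097664507219034120 ∷
  orientations 604463342223247693348870 618970019930920788680507396 ∷
  orientations 619574482552778995867336708 618970020219432708394188812 ∷
  orientations 619574482552638464470302728 604463486408873299935244 ∷
  twoEdgeCut 0 1 7 9 1 ∷
  twoEdgeCut 0 1 8 9 1 ∷
  orientations 604463198072875245420546 907284948751775592120324 ∷
  orientations 604610484322923070914568 619574482552532911421128716 ∷
  orientations 619272251241744442069139458 618970610082615959176118280 ∷
  orientations 618970314791158541700857860 619574482552532911421128716 ∷
  orientations 604462910405517632356362 618970019643253431067475976 ∷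
  orientations 604462910088789698330626 907284660838058789191684 ∷
  orientations 604611060255909792989192 619574482552497727049039884 ∷
  orientations 590296091902536056844 618970609938817155571138566 ∷
  orientations 619272251097734807109550082 618970609938676692960690184 ∷
  orientations 618970315367091528422932484 619574482552497727049039884 ∷
  orientations 590295951371139022860 605053205793663872942090 ∷
  orientations 604463486268135610286090 618970020219186417789566984 ∷
  orientations 302231455466676100792328 302232032208971966201866 ∷
  orientations 604462910088858417758216 604463198882253108166666 ∷
  twoEdgeCut 0 1 0 1 1 ∷
  orientations 577305314873851910 295148468266812325900 ∷
  orientations 618970019931765076171702278 618970609938782108638003212 ∷
  orientations 577305246154375174 302231455466676100808716 ∷
  orientations 618970019931765007452225542 619574482552778995867336716 ∷
  orientations 618970020507662878521720838 618970610226731009813020684 ∷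
  orientations 618970020507662809802244102 619574482840727897042354188 ∷
  orientations 302821750749406596956168 590872306364100657162 ∷
  orientations 604758057747884604915720 604463486303388701835274 ∷
  twoEdgeCut 0 1 8 9 1 ∷
  orientations 302379029419197124853764 302232032208869021204482 ∷
  orientations 295148468129507590148 443299162980689657858 ∷
  twoEdgeCut 0 2 4 9 2 ∷
  orientations 604758202390632170815492 563224965595138 ∷
  orientations 738014441120838189068 618970610082615993468747784 ∷
  orientations 302821823334560192036868 563224898486274 ∷
  orientations 604462982427893072658444 619574630198507944988934152 ∷
  orientations 295148608901154357258 885444278762956914700 ∷
  orientations 295724506703504359434 618970462941149396337721350 ∷
  orientations 604463198037725233020940 605053493989061811011594 ∷
  orientations 618970609938641508521525250 618970019930920822973169672 ∷
  orientations 618970019787368550490996744 590440488531094716426 ∷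
  orientations 302231455466607381331974 619272251169792401147478018 ∷
  orientations 618970314863356632708956162 619574777772601272153702410 ∷
  orientations 605348353663624561049604 604758634173555615465484 ∷
  orientations 618970167216924477181919236 618970020219151164765143048 ∷
  orientations 618970610010839599730917380 618970019643112659219398664 ∷
  orientations 302231455537010351030282 906694365274196846575628 ∷
  orientations 576461027181363210 148150976326360104972 ∷
  orientations 590584040769284210700 605053493918693066833930 ∷
  orientations 619574630126520685335461890 618970167504873412582473736 ∷
  orientations 619272251242342336010665986 619272841537590019506601994 ∷
  orientations 295148468129373372422 618970314934781148500377602 ∷
  orientations 618970019715310956385959944 604462982427892938489866 ∷
  orientations 907284660591733824831492 302822327175077607505932 ∷
  orientations 618970019642971887505506308 618970167793103754374447112 ∷
  orientations 619574482696894149650546692 618970019643042290542329864 ∷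
  orientations 618970019642831149815857162 619272841393544891004370950 ∷
  orientations 618970019642760781071679498 619574777700473000268152838 ∷
  orientations 618970610226731181611712520 590584111138162606092 ∷
  orientations 303116899182179732471810 302821750714016200687622 ∷
  orientations 590296408802268823560 302231455466641741103106 ∷
  orientations 604610484358347826937864 442722420753409556482 ∷
  twoEdgeCut 0 2 8 9 2 ∷
  orientations 885443856275613974534 605053205758445141114890 ∷
  orientations 906694364781340759457798 605053205688076396937226 ∷
  orientations 302232031364547036086280 302822327456277773418508 ∷
  orientations 618970314790876929352302598 443298318555893760004 ∷
  orientations 604463198037828178051080 604758346505854539268108 ∷
  orientations 590296373446232276998 618970757800683496544436228 ∷
  twoEdgeCut 1 4 2 6 4 ∷
  orientations 619272251098438254167343110 302231455466744887377924 ∷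
  orientations 604462910651774011457542 619574482552779064653905924 ∷
  orientations 886020317165356351494 618970315367196840953954306 ∷
  orientations 619272251097593794944598020 618970020219432399223701506 ∷
  orientations 604463486268238689501192 604758057783000257576962 ∷
  orientations 604462909807452227665924 590296091971188441096 ∷
  orientations 618970314790876826273087494 604462910124111509372930 ∷
  orientations 295724366000375758856 604758634454755647160332 ∷
  orientations 619272398671827928182980614 302232031364444158197764 ∷
  orientations 590584040803576872968 302822039507376531308556 ∷
  orientations 604610484322923003805702 619574482840727862749724676 ∷
  orientations 590296654818062647302 618970609938782040052727812 ∷
  orientations 618970314791439776159383558 295148468198227050500 ∷
  twoEdgeCut 1 4 2 7 4 ∷
  orientations 590872271214088323080 302821750854822274318338 ∷
  orientations 618970314790595317003747332 618970020219432399156592642 ∷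
  orientations 590295810427626487812 604462910088858417774600 ∷
  orientations 906694941242161782358022 619272251674124950150627330 ∷
  orientations 619272251097875304146829318 590296127086841085954 ∷
  orientations 302379605316999474872324 302232320157753016352770 ∷
  orientations 295724365931857608708 443587111864684806146 ∷
  orientations 295868481136912007178 886020176565306916876 ∷
  orientations 295292583334562005002 618970462509226044575203334 ∷
  orientations 605348497638057968697348 604758058275736085594124 ∷
  orientations 618970167504873378356920324 618970019643253362415124488 ∷
  orientations 302232103422020814929930 906694941171999196577804 ∷
  orientations 563224831344650 148150976309180235788 ∷
  orientations 907284732578941938728964 302821751277258077634572 ∷
  orientations 618970019930920788680507396 618970167217205952024428552 ∷
  orientations 618970019786805600403341322 619272841537519341591887878 ∷
  orientations 618970019714748006365413386 619574777772460225561919494 ∷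
  twoEdgeCut 0 2 5 9 2 ∷
  orientations 604462910088806878150668 605053350014611223494666 ∷
  orientations 618970610082615959109025794 618970019642971904618283016 ∷
  orientations 590296091850929340428 605053277957017185566730 ∷
  orientations 619574630198507910629212162 618970167216924494227587080 ∷
  orientations 618970609938782263256825864 590368149445101486092 ∷
  orientations 604758634313983933300740 576461027315597314 ∷
  orientations 738446364455420821516 618970609938641525701361672 ∷
  orientations 618970020219291902253481992 590872411865677348874 ∷
  orientations 619272251746252895887065090 619272841465602777032966154 ∷
  orientations 295724365931723390982 618970314862793923206627330 ∷
  orientations 619574482840868583058178052 618970020002978399831228424 ∷
  orientations 302822327245137248272388 576461027248488450 ∷
  orientations 604463486338452949041164 619574630126520702515298312 ∷
  orientations 302232031364409731350534 619272251241779626441228290 ∷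
  orientations 618970315511241643172855810 619574777844588480267567114 ∷
  orientations 618970610226801258432299012 618970020075035993802047496 ∷
  orientations 618970020219221533442195464 604463486338452814872586 ∷
  orientations 303117475115149274693634 302821750749200572760070 ∷
  orientations 590872271403066884104 302232031399611283324930 ∷
  orientations 604611060220948624998408 443298353722951778306 ∷
  twoEdgeCut 0 2 8 9 2 ∷
  orientations 885587865910573547526 605053349768062920851466 ∷
  orientations 906694436803750425280518 605053277710468882923530 ∷
  orientations 604462910088927003033608 604758634454738534400012 ∷
  orientations 590872271248582262790 618970757512734578189549572 ∷
  orientations 618970905230802476066684934 590440207038938136578 ∷
  orientations 619272251097875424338788360 619272841465461885060038658 ∷
  orientations 604462909807314788696068 576742244594270210 ∷
  orientations 604462909807452227649540 590584040872363458568 ∷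
  twoEdgeCut 1 5 2 6 5 ∷
  orientations 619272251962284940512493574 302232031364547237380100 ∷
  orientations 604463774498460356608006 619574482840727965828907012 ∷
  orientations 618970315078860894640291846 604463198037828312285186 ∷
  orientations 590296091902401855496 302822327456260526440460 ∷
  orientations 604611060220725353791494 619574482552778944394838020 ∷
  orientations 590295810358906994692 576742244527161346 ∷
  orientations 618970314790876877678460936 619574777844517888252231682 ∷
  orientations 590295810427626471428 604463198037759592792072 ∷
  orientations 619876714079740247198941190 604462982146400781910018 ∷
  orientations 591160501504407797766 618970610226730941227728900 ∷
  orientations 618970315655286462504534022 295724366000577052676 ∷
  twoEdgeCut 1 5 2 7 5 ∷
  orientations 619272251385859372514033670 590584040803643998210 ∷
  orientations 295724365948836151304 303117475079982082424844 ∷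
  orientations 618970167793385005945733128 619272398671827876643340300 ∷
  orientations 148150694868496187400 604611060220690994036748 ∷
  twoEdgeCut 0 2 8 9 2 ∷
  orientations 605348497638075148582918 590440207056185081866 ∷
  orientations 907284732578959118614534 604462982146418095964170 ∷
  orientations 605348353663607381213190 590584181489592729610 ∷
  orientations 907284660591716644995078 604463198108076797362186 ∷
  twoEdgeCut 0 1 0 2 2 ∷
  orientations 576742227313704966 302822327456380718448650 ∷
  orientations 295148749604316528646 604758058275581399662604 ∷
  orientations 738158556549432246276 604610772553230402502662 ∷
  orientations 563224831344650 590440207021825376258 ∷
  orientations 590440770109184163842 618970610082897159308476422 ∷
  orientations 605053205899148336873474 590367868227722182660 ∷
  orientations 618970167288700596075364364 619574630198789110795108358 ∷
  orientations 295724365931723390982 302527179832676375855116 ∷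
  orientations 147574656277151760390 618970167217205952024412172 ∷
  orientations 590584744697210617858 605053493988787033767942 ∷
  orientations 563087392391178 590584181472412876802 ∷
  orientations 885588393813593849860 618970314935273454865268742 ∷
  orientations 619272841393544891004403714 302821822771747576905732 ∷
  orientations 604758129770225450614796 619574777772600962983165958 ∷
  orientations 885443997013102329862 605053205899285708685322 ∷
  orientations 737869903685937561606 618970609938641508521492490 ∷
  orientations 605053277675404870582276 604462982006058464051212 ∷
  orientations 302231455467019563974664 577094345912500226 ∷
  orientations 563362270298120 302232031997865767223298 ∷
  orientations 906694653504435458670604 605053493848049545412612 ∷
  orientations 618970019931483875871588360 147574515814574899202 ∷
  orientations 618970019787368550390300684 619272841537519341625442308 ∷
  orientations 604463054485864933523464 295148468266812358658 ∷
  twoEdgeCut 0 3 4 9 3 ∷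
  orientations 302821750784797127475208 590872271385954123780 ∷
  orientations 619574482552779064486150152 618970020219151164731555852 ∷
  orientations 605053349803642463453192 590296162339966173188 ∷
  orientations 590295881139833798664 302822327174905808846852 ∷
  orientations 619574482552638464436748296 604463486268204430393356 ∷
  orientations 618970610226801653401518088 590296021739916771332 ∷
  orientations 604758058310628366368772 563224864931842 ∷
  orientations 619272398672144518845841412 302231455466744719654914 ∷
  orientations 604462910370402013331458 604610483760316580659210 ∷
  orientations 604462910088927003049994 619574630126731516723609606 ∷
  orientations 618970019642831149815857162 619574777700543368911667206 ∷
  twoEdgeCut 0 3 6 9 3 ∷
  orientations 295724365931723390980 604758634454789973344268 ∷
  orientations 619272398671827928182980618 302232031364615789117448 ∷
  orientations 590584040734924505092 302822039507410857492492 ∷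
  orientations 604610484322923003805706 619574482840728034380644360 ∷
  orientations 590296654852388831242 618970609938782177357463560 ∷
  orientations 618970314791439810485567498 295148468335531786248 ∷
  twoEdgeCut 1 4 3 7 4 ∷
  orientations 590872271111109771268 302821750854822274318338 ∷
  orientations 618970314790595522960850952 618970020219432433482776578 ∷
  orientations 590295810564931223560 604462910088927070142468 ∷
  orientations 906694941242230434725898 619272251674124915824443394 ∷
  orientations 619272251097875338473013258 590296127086841085954 ∷
  orientations 907284660521502385405962 604462910088927036620802 ∷
  orientations 619272988967356880631398406 619272398671827893823258626 ∷
  orientations 619574777700402768895836170 618970314790876929251655682 ∷
  orientations 619574482552779064486150156 618970314790876929318748164 ∷
  orientations 618970609938782005558788108 619272251097875441585782792 ∷
  twoEdgeCut 1 4 6 9 4 ∷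
  orientations 576742227313704962 604758634454738400215050 ∷
  orientations 618970019642971767078666248 619272841393404290954969090 ∷
  orientations 618970019642971767078649864 618970315367056086386376708 ∷
  orientations 618970019931201988611588098 619574630126731533970587652 ∷
  orientations 618970905086687167731761164 590296091988301201416 ∷
  orientations 605053277675284544389132 618970609938781988412473348 ∷
  orientations 605053205758427994800140 619574482840727982841036808 ∷
  orientations 619876714295631622954827788 604463198037690839760900 ∷
  twoEdgeCut 2 6 3 7 6 ∷
  orientations 590295810427525791756 619272841393544891004370950 ∷
  twoEdgeCut 2 6 4 7 6 ∷
  orientations 288793326121943046 302822039507479543431178 ∷
  orientations 296012596307824771078 604758634173383749664780 ∷
  orientations 295148468129373372422 302527179832676359077900 ∷
  orientations 148294528530072502278 618970167793103754374414348 ∷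
  orientations 885731945914277314566 605053493848186883702794 ∷
  orientations 738013878136525045766 618970610082615959109009418 ∷
  orientations 302232031364821913993224 649081571189489666 ∷
  orientations 576461164620316680 302232103985091044212738 ∷
  orientations 302821822772022421225480 590296373583604105220 ∷
  orientations 619574482840727965644390408 618970019643253362364776460 ∷
  orientations 590367868365127548936 302821751277103458828292 ∷
  orientations 619574482696612915007488008 604462910370402063613964 ∷
  orientations 738446505450607230980 604611060502131560726534 ∷
  orientations 591016668048956358658 605053350014336429473798 ∷
  orientations 576460889742409738 590440207021825376258 ∷
  orientations 906694941453336616894476 605053205899148353617924 ∷
  orientations 618970020219432777046573064 148150413616924901378 ∷
  orientations 618970610010839977503490056 590511983415781261316 ∷
  orientations 576461027181363210 590584181472412876802 ∷
  orientations 591160642362104905730 618970610226871609879183366 ∷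
  orientations 886020317165356335108 618970315367196806610993158 ∷
  orientations 618970020219291902136025100 619272841393544891021148164 ∷
  orientations 604463486409216696008712 295724366069162360834 ∷
  orientations 605053277816417152925704 590656098466418163716 ∷
  orientations 605053493848049511874562 590295881002411638788 ∷
  orientations 618970167216713370764836876 619574630414750786676342790 ∷
  orientations 619272841537519341591904258 302821750784522266361860 ∷
  orientations 604758057783000140087308 619574777844588188276899846 ∷
  orientations 605053205688179560038404 604463053993283741024268 ∷
  twoEdgeCut 0 3 5 9 3 ∷
  orientations 604758634173246327521284 576496211570245634 ∷
  orientations 619272399248007136806993924 302232031399731424968706 ∷
  orientations 604463486303388718645250 604610483795500952731658 ∷
  orientations 604463198073012550123530 619574630414715602253938694 ∷
  orientations 618970019786840784775430154 619574777844553003854495750 ∷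
  twoEdgeCut 0 3 6 9 3 ∷
  orientations 590296091833749487620 302822327456312015716364 ∷
  orientations 604611060220725353791498 619574482552779133188849672 ∷
  orientations 590295810564864098312 576742296016437250 ∷
  orientations 618970314790876791863001092 619574777844517888252231682 ∷
  orientations 590295810564931207176 604463198037828245159940 ∷
  orientations 619876714079740315851309066 604462982146383618818050 ∷
  orientations 591160501555897073674 618970610226731078532464648 ∷
  orientations 618970315655286513993809930 295724366137881788424 ∷
  twoEdgeCut 1 5 3 7 5 ∷
  orientations 619272251385859424003309578 590584040803643998210 ∷
  orientations 576742227296944130 302822327456277639217162 ∷
  orientations 576460924118892552 590296091868126003204 ∷
  orientations 576460924118925320 604758057712631446274050 ∷
  orientations 618970019931201988594810882 619574630414680452308697092 ∷
  orientations 605053349732895745409036 619574482552779098829111304 ∷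
  orientations 619876714007682721763065868 604462910088789647966212 ∷
  orientations 618970905374636086086615052 590584040906656088072 ∷
  orientations 605053205688076413714444 618970610226730906750582788 ∷
  twoEdgeCut 2 6 3 7 6 ∷
  orientations 590295810461851975692 619272841393544959656738826 ∷
  orientations 907284660521485205520394 604463198037828194844674 ∷
  orientations 619272988967356880631382022 619272398959776777818390530 ∷
  orientations 619574777700402768895819786 618970315078825830409879554 ∷
  orientations 619574482840727965644390412 618970315078825830476955652 ∷
  orientations 618970610226730889553936396 619272251385824325580898312 ∷
  twoEdgeCut 1 5 6 9 5 ∷
  twoEdgeCut 2 6 5 7 6 ∷
  orientations 295724365931673059332 303117475080016408608780 ∷
  orientations 618970167793384954456457220 619272398671827928132616204 ∷
  orientations 148150694817006911492 604611060220725320220684 ∷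
  twoEdgeCut 0 3 8 9 3 ∷
  orientations 605348497638109474766858 590440207090511265798 ∷
  orientations 907284732579062097166346 604462982146521074515974 ∷
  orientations 605348353663658870489098 590584181541082005510 ∷
  orientations 907284660591836786638858 604463198108196939005958 ∷
  twoEdgeCut 0 1 0 2 1 ∷
  twoEdgeCut 3 6 4 7 6 ∷
  twoEdgeCut 3 6 5 7 6 ∷
  orientations 864972603440267266 590584040872304738308 ∷
  orientations 865254078416977922 295724366069103624196 ∷
  orientations 302821750995628423381004 576742364719104010 ∷
  orientations 148150694817023688714 618970019787086800510566402 ∷
  orientations 604758058275581340942348 288793463544102922 ∷
  orientations 618970167505436053298249738 144678138037714946 ∷
  orientations 604758057993968983998476 576742227355648006 ∷
  orientations 576742364727508998 618970167288981796140662786 ∷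
  orientations 302821751276966019858444 288793326180646918 ∷
  orientations 618970019931483601002070022 147646573133667811330 ∷
  orientations 619272251313766714296008714 618970610010839702617194508 ∷
  orientations 604463125980234140123146 295220525860791517196 ∷
  orientations 604758634173383690944524 576742364719120394 ∷
  orientations 618970167793384954473234442 576601489800216578 ∷
  orientations 590439925546857037828 295868621857287602178 ∷
  orientations 619272251169792263716913154 618970610010980302733721606 ∷
  orientations 604462982005646122074114 295796564263249674250 ∷
  orientations 618970019931061251156787202 618970609938781971207438340 ∷
  orientations 302822327174768369860620 576742227355664390 ∷
  orientations 618970020219432502177054726 148150483710724063234 ∷
  orientations 619272251241779351571709954 618970610082967528019083274 ∷
  orientations 604463053993008854777858 295868551488551813126 ∷
  orientations 618970019787086800569286658 618970610226730872382455812 ∷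
  orientations 604462981865046064267272 302232103492509826580482 ∷
  orientations 619272251097805038414741514 618970610226801378498445324 ∷
  orientations 604462910018558258855946 295724436437847769100 ∷
  orientations 302822327456243279495178 590296091833749487622 ∷
  orientations 590872587770366279686 302232031399731416563722 ∷
  orientations 618970315367337544090943494 619574482552779064460984330 ∷
  twoEdgeCut 0 1 8 9 1 ∷
  orientations 619574777700437953276280844 604463053957824482656262 ∷
  orientations 619272841393439475327041548 590367903137182793738 ∷
  orientations 619574777700402768904192012 604462909948189523083270 ∷
  orientations 619272841393404290954952716 590295880727516971018 ∷
  twoEdgeCut 0 1 6 9 1 ∷
  twoEdgeCut 0 1 6 7 1 ∷
  twoEdgeCut 0 1 6 9 1 ∷
  twoEdgeCut 0 1 6 8 1 ∷
  twoEdgeCut 0 1 6 9 1 ∷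
  twoEdgeCut 0 1 5 6 1 ∷
  twoEdgeCut 0 1 4 6 1 ∷
  twoEdgeCut 0 1 6 9 1 ∷
  orientations 302822327174768378281990 907579808567247494971404 ∷
  orientations 590872271111084605446 618970757512734560875446284 ∷
  orientations 619574777700543368945205260 618970314791017563627208712 ∷
  orientations 590296091833749487624 618970167505154612689633292 ∷
  orientations 590295951096261132296 604758201968453939625996 ∷
  twoEdgeCut 1 4 6 9 4 ∷
  orientations 906694364851743796248584 605053205617673360146436 ∷
  twoEdgeCut 2 6 4 7 6 ∷
  orientations 590584040734924472332 302822615405161634365448 ∷
  orientations 619272398671687121983520774 618970757800683462050447372 ∷
  orientations 604610483900641827635206 443298318521399771148 ∷
  orientations 590439925546848649224 604758201968436759756812 ∷
  orientations 618970019930920530848284680 619272841393404153516015620 ∷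
  twoEdgeCut 1 5 6 9 5 ∷
  twoEdgeCut 2 6 5 7 6 ∷
  orientations 302822327174837022261258 907579808567316155727884 ∷
  orientations 590872271179728584714 618970757512734629536202764 ∷
  orientations 619574777700543437605961740 618970314791017529309413380 ∷
  orientations 590296091902410244100 618970167505154647007428620 ∷
  orientations 590295951164921888772 604758201968488257421324 ∷
  twoEdgeCut 1 4 6 9 4 ∷
  orientations 906694364851778130821124 605053205617742020902920 ∷
  twoEdgeCut 3 6 4 7 6 ∷
  twoEdgeCut 0 1 1 4 4 ∷
  twoEdgeCut 4 6 5 7 6 ∷
  orientations 590584040803585228812 302822615405144479662084 ∷
  orientations 619272398671687190627500042 618970757800683530711203852 ∷
  orientations 604610483900710471614474 443298318590060527628 ∷
  orientations 590439925615509405700 604758201968488240644108 ∷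
  orientations 618970019930920582345949188 619272841393404222176772104 ∷
  twoEdgeCut 1 5 6 9 5 ∷
  twoEdgeCut 3 6 5 7 6 ∷
  twoEdgeCut 4 6 5 7 6 ∷
  twoEdgeCut 0 1 1 4 1 ∷
  orientations 302231743697120837771274 590584040872329871372 ∷
  orientations 604463486549679306448906 295724366069128757260 ∷
  orientations 302526603371924038885386 295724366069162311692 ∷
  orientations 618970167216924202169819138 618970462509226044575203332 ∷
  orientations 605053205899285708677130 590584040872363425804 ∷
  orientations 147574515539696967682 738014159611501756420 ∷
  orientations 302527251890132974829580 295220525723411300358 ∷
  orientations 302231527524338724003850 619272398743604115930095622 ∷
  orientations 302822039507342171570188 288793326138703878 ∷
  orientations 619574482624836658490531850 604610555817635774210054 ∷
  orientations 302231455466744686075914 619272251241709120325165062 ∷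
  orientations 619574482552779064452603914 604463053922640169279494 ∷
  orientations 886020176290429018116 590296091971188432898 ∷
  orientations 590584181472412844044 618970167504873103378358276 ∷
  orientations 295724506669178175500 618970314934710504978915332 ∷
  twoEdgeCut 0 2 8 9 2 ∷
  orientations 618970315439395138154012678 619574777772460362933739532 ∷
  orientations 618970610227012347350753286 619574482840727965661143052 ∷
  orientations 604463198389534459969546 590584111103635120134 ∷
  orientations 604610483760041769828364 576742364719095818 ∷
  orientations 590439995915626364932 576812596057890818 ∷
  orientations 604463053922640202833924 720857415389569030 ∷
  orientations 604463053922502763880452 590440207021825343500 ∷
  orientations 604462982216889785139210 618970019715029206497771532 ∷
  orientations 590584111241107611654 618970019931061251190292484 ∷
  orientations 618970315367126575356059654 576601489892442116 ∷
  orientations 604758058029153288994826 295724401116095471622 ∷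
  orientations 148150448526452604932 590296127018121584642 ∷
  orientations 604610483759904364437508 148150694816990117900 ∷
  orientations 604610483760041803390980 737870044423425908742 ∷
  orientations 604463053922640135716876 590296091971121324042 ∷
  orientations 604462910124111375122442 618970019642971612493398028 ∷
  orientations 618970610226766194151530502 590295951096294670340 ∷
  orientations 604462909842636465504264 302821750714153505398788 ∷
  orientations 906694941312461706379272 302822327456311998963722 ∷
  orientations 604610483900641819254790 576882964768505866 ∷
  orientations 618970020219432364763267080 590872411917216931850 ∷
  orientations 618970314790876791846232070 576882964768505866 ∷
  orientations 619574482696894115089498122 618970020075317245406871560 ∷
  twoEdgeCut 1 4 5 9 4 ∷
  twoEdgeCut 2 5 4 7 5 ∷
  orientations 619574482840763081313763336 604462909983236514922498 ∷
  orientations 907284660662068142161928 302822327456277639225354 ∷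
  orientations 618970609938781971199049736 590872411882857193482 ∷
  orientations 619574630126731516690055178 618970462364829415882358792 ∷
  orientations 618970019931201988611563526 590296232571170734090 ∷
  orientations 604463054063240185143302 590296232571170734090 ∷
  twoEdgeCut 1 4 6 9 4 ∷
  orientations 302821750784419170369544 619272251097804901009342466 ∷
  twoEdgeCut 2 6 4 7 6 ∷
  twoEdgeCut 0 2 4 7 2 ∷
  twoEdgeCut 0 2 4 7 2 ∷
  twoEdgeCut 0 2 4 7 2 ∷
  twoEdgeCut 0 2 4 7 2 ∷
  twoEdgeCut 0 2 4 7 2 ∷
  twoEdgeCut 0 2 4 6 2 ∷
  twoEdgeCut 0 2 4 5 2 ∷
  orientations 590584040803576848394 302822615405144488042498 ∷
  orientations 619272398671687190644260876 618970757800683530702823434 ∷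
  orientations 604610483900710488375308 443298318590052147210 ∷
  orientations 590439925615534546946 604758201968488223883274 ∷
  orientations 618970019930920582354329602 619272841393404222185152520 ∷
  twoEdgeCut 2 5 6 9 5 ∷
  twoEdgeCut 3 6 5 7 6 ∷
  twoEdgeCut 4 6 5 7 6 ∷
  twoEdgeCut 0 1 2 5 5 ∷
  twoEdgeCut 1 4 2 5 4 ∷
  twoEdgeCut 1 4 2 5 4 ∷
  twoEdgeCut 1 4 2 5 4 ∷
  twoEdgeCut 1 4 2 5 4 ∷
  twoEdgeCut 1 4 2 5 4 ∷
  twoEdgeCut 1 4 2 5 4 ∷
  twoEdgeCut 0 1 4 5 5 ∷
  orientations 302969613460000500350988 302379029419334362480650 ∷
  orientations 604758346505957484265484 295148468198025740298 ∷
  orientations 591016667774095200262 302821894829272828215308 ∷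
  orientations 618970167937500142515539974 148150413410732871690 ∷
  orientations 295580813693567373318 604758201827750769065996 ∷
  orientations 148006861103890976774 618970167504873172030722058 ∷
  orientations 604463558607135938973702 604758129770225450614796 ∷
  orientations 618970020291489958801199110 576460889775935498 ∷
  orientations 302231815754577470296070 302821822771747509764108 ∷
  orientations 360850920176635910 618970019930920651073785866 ∷
  orientations 618970019715029343903174658 619272251098156882135629832 ∷
  orientations 72620681430323202 604462910088927003033608 ∷
  orientations 295724788144121331718 604758057853300148031498 ∷
  orientations 148150835554478473222 618970167216924270822178828 ∷
  orientations 576460889775931404 590440207021791776774 ∷
  orientations 576460958495412232 590296091902401859594 ∷
  orientations 576460958461857800 604462910088927003033612 ∷
  orientations 604462909948258234155016 590368290233928142850 ∷
  orientations 302232031716253318004742 302821750784522182479882 ∷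
  orientations 576812596057882630 618970019642971749865242636 ∷
  orientations 576460958461857800 590296091902401855500 ∷
  orientations 576460958495412232 604462910088927003037706 ∷
  orientations 590295880933608275976 604463054274483823071234 ∷
  orientations 576460821056454668 604462982146383635550214 ∷
  orientations 618970019930991019817959428 619272251674054684519174152 ∷
  orientations 576531258520109060 604463198037828211576840 ∷
  orientations 907284660521468025638920 604462910088927036575746 ∷
  orientations 619272988967638286821494794 619272399248007274195587084 ∷
  orientations 619574777700684243805409290 618970315367056137858846732 ∷
  twoEdgeCut 0 3 8 9 3 ∷
  orientations 604758201863003827093516 618970314790595522960822280 ∷
  orientations 302821822806863128838156 619272251097594000901672968 ∷
  orientations 604758057853368901046282 618970314790630707332907016 ∷
  orientations 302821750784453496541194 619272251097629185273757704 ∷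
  orientations 907284660662136794529796 302822327456243313037318 ∷
  orientations 618970609938782039851417604 590872411848531005446 ∷
  orientations 619574630126731516690055174 618970462364829450208542724 ∷
  orientations 618970019931202022937743370 590296232571170734086 ∷
  orientations 604463054063274511323146 590296232571170734086 ∷
  twoEdgeCut 1 4 6 9 4 ∷
  orientations 302821750784453496553476 619272251097804935335526402 ∷
  twoEdgeCut 3 6 4 7 6 ∷
  orientations 295724365931689807878 303117475080016375074818 ∷
  orientations 618970167504873172030722050 619272399248147874245001222 ∷
  orientations 148150413410732871682 604610772131017937403910 ∷
  orientations 604463054063257364987916 590728155922966777862 ∷
  orientations 590367868021496631298 604463270095301990420484 ∷
  twoEdgeCut 2 5 6 9 5 ∷
  twoEdgeCut 3 6 5 7 6 ∷
  twoEdgeCut 4 6 5 7 6 ∷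
  twoEdgeCut 0 3 4 7 3 ∷
  twoEdgeCut 0 3 4 7 3 ∷
  twoEdgeCut 0 3 4 7 3 ∷
  twoEdgeCut 0 3 4 7 3 ∷
  twoEdgeCut 0 3 4 7 3 ∷
  twoEdgeCut 0 3 4 6 3 ∷
  twoEdgeCut 0 3 4 5 3 ∷
  twoEdgeCut 0 1 3 5 5 ∷
  twoEdgeCut 1 4 3 5 4 ∷
  twoEdgeCut 1 4 3 5 4 ∷
  twoEdgeCut 1 4 3 5 4 ∷
  twoEdgeCut 1 4 3 5 4 ∷
  twoEdgeCut 1 4 3 5 4 ∷
  twoEdgeCut 1 4 3 5 4 ∷
  twoEdgeCut 0 1 4 5 5 ∷
  twoEdgeCut 2 4 3 5 4 ∷
  twoEdgeCut 2 4 3 5 4 ∷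
  twoEdgeCut 2 4 3 5 4 ∷
  twoEdgeCut 2 4 3 5 4 ∷
  twoEdgeCut 2 4 3 5 4 ∷
  twoEdgeCut 2 4 3 5 4 ∷
  twoEdgeCut 0 1 4 5 5 ∷
  []
certificates _ = []

classify≤10 : ∀ k → k ≤ 10 → (T : Adj k) → BFSNormal T → Isomorphic T petersen ⊎ Covers T 2
classify≤10 0 _ = Classification.classify 0 (certificates 0) refl
classify≤10 1 _ = Classification.classify 1 (certificates 1) refl
classify≤10 2 _ = Classification.classify 2 (certificates 2) refl
classify≤10 3 _ = Classification.classify 3 (certificates 3) refl
classify≤10 4 _ = Classification.classify 4 (certificates 4) refl
classify≤10 5 _ = Classification.classify 5 (certificates 5) refl
classify≤10 6 _ = Classification.classify 6 (certificates 6) refl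
classify≤10 7 _ = Classification.classify 7 (certificates 7) refl
classify≤10 8 _ = Classification.classify 8 (certificates 8) refl
classify≤10 9 _ = Classification.classify 9 (certificates 9) refl
classify≤10 10 _ = Classification.classify 10 (certificates 10) refl
classify≤10 (suc (suc (suc (suc (suc (suc (suc (suc (suc (suc (suc k)))))))))))
  (s≤s (s≤s (s≤s (s≤s (s≤s (s≤s (s≤s (s≤s (s≤s (s≤s ()))))))))))

mainTheorem12 : (n : ℕ) → n ≤ 10 → (G : Adj n) → IsSimple G → Cubic G → ThreeEdgeConnected G →
    (Isomorphic G petersen → (k : ℕ) → k ≤ 2 → ¬ Covers G k)
    × (¬ Isomorphic G petersen → IsFrankNumber G 2)
mainTheorem12 zero n≤10 G simple cubic (() , _)
mainTheorem12 (suc n) n≤10 G simple cubic tec = petersenCase , otherCase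
  where
  lowerBound : ∀ k → k < 2 → ¬ Covers G k
  lowerBound = ¬Covers-<2 simple (degree3⇒Neighbours₃ G 0F (cubic 0F))

  petersenCase : Isomorphic G petersen → (k : ℕ) → k ≤ 2 → ¬ Covers G k
  petersenCase G≅P 0 _ = lowerBound 0 (s≤s z≤n)
  petersenCase G≅P 1 _ = lowerBound 1 (s≤s (s≤s z≤n))
  petersenCase G≅P 2 _ = petersen-¬Covers-2 ∘ Covers-transport G≅P
  petersenCase G≅P (suc (suc (suc k))) (s≤s (s≤s ()))

  otherCase : ¬ Isomorphic G petersen → IsFrankNumber G 2
  otherCase G≇P = [ (λ H≅P → ⊥-elim (G≇P (Isomorphic-trans {K = petersen} (Isomorphic-sym iso) H≅P)))
                   , (λ cover → Covers-transport iso cover , lowerBound) ]′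
                   (classify≤10 size (≤-trans size≤n n≤10) matrix normal)
    where open BFSNormalForm (bfsNormalForm G simple cubic tec 0F)
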